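{- Let $\mathcal{A}$ be a finite group and let $\alpha$ be an automorphism of $\mathcal{A}$ of order $|\langle\alpha\rangle|$. Then for any positive integer $r$ and any subgroup $\mathcal{S}$ of $\mathcal{A}$ with $\alpha(\mathcal{S})=\mathcal{S}$: $$|\tilde F_{(\alpha,r)}(\mathcal{S})|=\begin{cases}\sum_{d\mid r}\mu(r/d)\,|\tilde{\tilde F}_{(\alpha,d)}(\mathcal{S})| & \text{if $r$ divides $|\langle\alpha\rangle|$ and $r$ is odd},\\ \sum_{d\mid r}\mu(r/d)\,|\tilde{\tilde F}_{(\alpha,d)}(\mathcal{S})|-|\tilde I_{(\alpha,r/2)}(\mathcal{S})| & \text{if $r$ divides $|\langle\alpha\rangle|$ and $r$ is even},\\ 0 & \text{if $r$ does not divide $|\langle\alpha\rangle|$;}\end{cases}$$ $$|\tilde F^o_{(\alpha,r)}(\mathcal{S})|=\begin{cases}\sum_{d\mid r}\mu(r/d)\,|\tilde{\tilde F}^o_{(\alpha,d)}(\mathcal{S})| & \text{if $r$ divides $|\langle\alpha\rangle|$},\\ 0&\text{otherwise;}\end{cases}$$ $$|\tilde I_{(\alpha,r)}(\mathcal{S})|=\begin{cases}\sum_{d\mid r,\ r/d\text{ odd}}\mu(r/d)\,|\tilde{\tilde I}_{(\alpha,d)}(\mathcal{S})| & \text{if $2r$ divides $|\langle\alpha\rangle|$},\\ 0&\text{otherwise.}\end{cases}$$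
   Context: $\mathcal{A}$ is a finite group with identity $e$, $\mu$ denotes the number-theoretic Möbius function. For a subgroup $\mathcal{S}$ with $\alpha(\mathcal{S})=\mathcal{S}$ and a positive integer $n$: $\tilde{\tilde F}_{(\alpha,n)}(\mathcal{S})=\{g\in\mathcal{S}:\alpha^n(g)=g,\ g^{ -1}\neq g\}$; $\tilde{\tilde I}_{(\alpha,n)}(\mathcal{S})=\{g\in\mathcal{S}:\alpha^n(g)=g^{ -1},\ g^{ -1}\neq g\}$; $\tilde{\tilde F}^o_{(\alpha,n)}(\mathcal{S})=\{g\in\mathcal{S}:\alpha^n(g)=g,\ g^{ -1}=g\neq e\}$; $\tilde F_{(\alpha,n)}(\mathcal{S})=\{g\in\mathcal{S}: g\neq g^{ -1},\ \alpha^n(g)=g,\ \alpha^l(g)\neq g,\ \alpha^l(g)\neq g^{ -1}\ (1\le l<n)\}$; $\tilde I_{(\alpha,n)}(\mathcal{S})=\{g\in\mathcal{S}: g\neq g^{ -1},\ \alpha^n(g)=g^{ -1},\ \alpha^l(g)\neq g,\ \alpha^l(g)\neq g^{ -1}\ (1\le l<n)\}$; $\tilde F^o_{(\alpha,n)}(\mathcal{S})=\{g\in\mathcal{S}: g^{ -1}=g\neq e,\ \alpha^n(g)=g,\ \alpha^l(g)\neq g\ (1\le l<n)\}$. -}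

module Defs where

open import Level using (0ℓ)
open import Data.Bool using (Bool; true; false; if_then_else_)
open import Data.Nat as ℕ using (ℕ; zero; suc; _+_; _*_; _≤_; _<_; _/_)
open import Data.Nat.Divisibility using (_∣_; _∣?_)
open import Data.Nat.Primality using (Prime; prime?)
open import Data.Nat.Properties using (_≤?_)
open import Data.Integer as ℤ using (ℤ; +_)
open import Data.Fin using (Fin; toℕ)
open import Data.Fin.Properties using (all?; _≟_)
open import Data.List using (List; length; filter; allFin; upTo; map)
open import Data.List as List using ()
open import Data.Product using (_×_)
open import Function using (id; _∘_)
open import Function.Definitions using (Bijective)
open import Relation.Unary using (Pred; Decidable)
open import Relation.Nullary using (¬_; Dec; does)
open import Relation.Nullary.Decidable using (_×-dec_; _→-dec_; ¬?)
open import Relation.Binary.PropositionalEquality using (_≡_)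
open import Algebra.Structures using (IsGroup)

-- Möbius function (number-theoretic), defined as in the classical way:
-- μ(n) = 0 if some d ≥ 2 has d² ∣ n, otherwise μ(n) = (-1)^ω(n),
-- ω(n) = number of primes dividing n.  (μ 0 is irrelevant; only used
-- at positive arguments.)

squarefree? : ℕ → Bool
squarefree? n = does (all? {n = suc n} λ (d : Fin (suc n)) →
  (2 ≤? toℕ d) →-dec ¬? ((toℕ d * toℕ d) ∣? n))

ω : ℕ → ℕ
ω n = length (filter (λ p → prime? p ×-dec (p ∣? n)) (upTo (suc n)))

μ : ℕ → ℤ
μ n = if squarefree? n then (ℤ.-1ℤ ℤ.^ ω n) else + 0

divSumIf : (r : ℕ) → (ℕ → ℕ → Bool) → (ℕ → ℕ → ℤ) → ℤ
divSumIf r c f = List.foldr ℤ._+_ (+ 0) (map term (upTo r))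
  where
  term : ℕ → ℤ
  term k = if does (suc k ∣? r)
             then (if c (suc k) (r / suc k) then f (suc k) (r / suc k) else + 0)
             else + 0

divSum : (r : ℕ) → (ℕ → ℕ → ℤ) → ℤ
divSum r f = divSumIf r (λ _ _ → true) f

odd? : ℕ → Bool
odd? m = does (¬? (2 ∣? m))

iter : ∀ {n} → (Fin n → Fin n) → ℕ → Fin n → Fin n
iter α zero    = id
iter α (suc l) = α ∘ iter α l

count : ∀ {n} {P : Pred (Fin n) 0ℓ} → Decidable P → ℕ
count {n} P? = length (filter P? (allFin n))

-- A finite group is represented (up to isomorphism) as a group
-- structure on Fin n, with propositional equality.

record FiniteGroup : Set where
  field
    n       : ℕ
    _∙_     : Fin n → Fin n → Fin n
    e       : Fin n
    _⁻¹     : Fin n → Fin n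
    isGroup : IsGroup _≡_ _∙_ e _⁻¹

record IsAutomorphism (A : FiniteGroup) (α : Fin (FiniteGroup.n A) → Fin (FiniteGroup.n A)) : Set where
  open FiniteGroup A
  field
    hom       : ∀ x y → α (x ∙ y) ≡ α x ∙ α y
    bijective : Bijective _≡_ _≡_ α

record IsOrderOf {n : ℕ} (α : Fin n → Fin n) (o : ℕ) : Set where
  field
    pos     : 1 ≤ o
    id-at-o : ∀ g → iter α o g ≡ g
    minimal : ∀ l → 1 ≤ l → l < o → ¬ (∀ g → iter α l g ≡ g)

record IsSubgroup (A : FiniteGroup) (S : Pred (Fin (FiniteGroup.n A)) 0ℓ) : Set where
  open FiniteGroup A
  field
    e∈S   : S e
    ∙-closed : ∀ {x y} → S x → S y → S (x ∙ y)
    ⁻¹-closed : ∀ {x} → S x → S (x ⁻¹)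

record IsInvariant {n : ℕ} (α : Fin n → Fin n) (S : Pred (Fin n) 0ℓ) : Set where
  field
    image⊆ : ∀ {g} → S g → S (α g)
    ⊆image : ∀ {h} → S h → Data.Product.Σ (Fin n) (λ g → S g × α g ≡ h)

module Sets (A : FiniteGroup) (α : Fin (FiniteGroup.n A) → Fin (FiniteGroup.n A))
            (S : Pred (Fin (FiniteGroup.n A)) 0ℓ) (S? : Decidable S) where
  open FiniteGroup A

  NoEarly : ℕ → Fin n → Set
  NoEarly m g = ∀ (l : Fin m) → 1 ≤ toℕ l → ¬ (iter α (toℕ l) g ≡ g) × ¬ (iter α (toℕ l) g ≡ g ⁻¹)

  NoEarlyFix : ℕ → Fin n → Set
  NoEarlyFix m g = ∀ (l : Fin m) → 1 ≤ toℕ l → ¬ (iter α (toℕ l) g ≡ g)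

  FF : ℕ → Pred (Fin n) 0ℓ
  FF m g = S g × iter α m g ≡ g × ¬ (g ⁻¹ ≡ g)

  II : ℕ → Pred (Fin n) 0ℓ
  II m g = S g × iter α m g ≡ g ⁻¹ × ¬ (g ⁻¹ ≡ g)

  FFo : ℕ → Pred (Fin n) 0ℓ
  FFo m g = S g × iter α m g ≡ g × g ⁻¹ ≡ g × ¬ (g ≡ e)

  F : ℕ → Pred (Fin n) 0ℓ
  F m g = S g × ¬ (g ≡ g ⁻¹) × iter α m g ≡ g × NoEarly m g

  I : ℕ → Pred (Fin n) 0ℓ
  I m g = S g × ¬ (g ≡ g ⁻¹) × iter α m g ≡ g ⁻¹ × NoEarly m g

  Fo : ℕ → Pred (Fin n) 0ℓ
  Fo m g = S g × g ⁻¹ ≡ g × ¬ (g ≡ e) × iter α m g ≡ g × NoEarlyFix m g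

  noEarly? : ∀ m g → Dec (NoEarly m g)
  noEarly? m g = all? λ l →
    (1 ≤? toℕ l) →-dec (¬? (iter α (toℕ l) g ≟ g) ×-dec ¬? (iter α (toℕ l) g ≟ g ⁻¹))

  noEarlyFix? : ∀ m g → Dec (NoEarlyFix m g)
  noEarlyFix? m g = all? λ l → (1 ≤? toℕ l) →-dec ¬? (iter α (toℕ l) g ≟ g)

  FF? : ∀ m → Decidable (FF m)
  FF? m g = S? g ×-dec (iter α m g ≟ g) ×-dec ¬? (g ⁻¹ ≟ g)

  II? : ∀ m → Decidable (II m)
  II? m g = S? g ×-dec (iter α m g ≟ g ⁻¹) ×-dec ¬? (g ⁻¹ ≟ g)

  FFo? : ∀ m → Decidable (FFo m)
  FFo? m g = S? g ×-dec (iter α m g ≟ g) ×-dec (g ⁻¹ ≟ g) ×-dec ¬? (g ≟ e)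

  F? : ∀ m → Decidable (F m)
  F? m g = S? g ×-dec ¬? (g ≟ g ⁻¹) ×-dec (iter α m g ≟ g) ×-dec noEarly? m g

  I? : ∀ m → Decidable (I m)
  I? m g = S? g ×-dec ¬? (g ≟ g ⁻¹) ×-dec (iter α m g ≟ g ⁻¹) ×-dec noEarly? m g

  Fo? : ∀ m → Decidable (Fo m)
  Fo? m g = S? g ×-dec (g ⁻¹ ≟ g) ×-dec ¬? (g ≟ e) ×-dec (iter α m g ≟ g) ×-dec noEarlyFix? m g

  |FF| |II| |FFo| |F| |I| |Fo| : ℕ → ℕ
  |FF|  m = count (FF? m)
  |II|  m = count (II? m)
  |FFo| m = count (FFo? m)
  |F|   m = count (F? m)
  |I|   m = count (I? m)
  |Fo|  m = count (Fo? m)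

-- The identities are proved one element at a time and then summed over the group.
-- Fix g ∈ S with g⁻¹ ≠ g and let τ be the least l ≥ 1 with α^l g ∈ {g, g⁻¹}; it exists
-- because α^o = id.  Since α commutes with inversion, either α^τ g = g, and then
-- α^d g = g ⇔ τ ∣ d while α^d g is never g⁻¹; or α^τ g = g⁻¹, and then α^d g = g ⇔ 2τ ∣ d
-- and α^d g = g⁻¹ ⇔ τ ∣ d, 2τ ∤ d.  Hence the indicator of g ∈ F̃̃_(α,d) is [p ∣ d] with
-- p ∈ {τ, 2τ}, those of g ∈ F̃_(α,r) and g ∈ Ĩ_(α,r) are [τ = r] or 0, and the claims
-- reduce to the Möbius identities Σ_{d∣r} μ(r/d) [p ∣ d] = [p = r] and
-- Σ_{d∣r, r/d odd} μ(r/d) [τ ∣ d, 2τ ∤ d] = [τ = r].  For g⁻¹ = g ≠ e the same analysis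
-- applies with {g, g⁻¹} = {g}.

module Submission where

open import Defs
open import Level using (0ℓ)
open import Data.Bool using (true; false; if_then_else_)
open import Data.Nat as ℕ
  using (ℕ; zero; suc; _+_; _*_; _/_; _%_; _≤_; _<_; z≤n; s≤s; NonZero; _≟_)
import Data.Nat.Properties as ℕP
open import Data.Nat.Divisibility
open import Data.Nat.Primality
open import Data.Nat.Primality.Factorisation using (factorise)
open import Data.Nat.ListAction using (product)
open import Data.Nat.Coprimality using (Coprime; coprime-divisor)
open import Data.Nat.DivMod using (m*n/n≡m; m/n*n≡m; m*n/o*n≡m/o; m≡m%n+[m/n]*n; m%n<n)
open import Data.Integer as ℤ using (ℤ; +_; -_; _-_) renaming (_+_ to _+ℤ_; _*_ to _*ℤ_)
import Data.Integer.Properties as ℤP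
open import Data.Fin as Fin using (Fin; toℕ)
open import Data.Fin.Properties using (toℕ<n; all?; toℕ-fromℕ<) renaming (_≟_ to _≟ᶠ_)
open import Data.List as List using (List; []; _∷_; filter; length; map; applyUpTo; upTo; tabulate)
import Data.List.Properties as ListP
open import Data.Product using (Σ; _×_; _,_; proj₁; proj₂)
open import Data.Sum using (_⊎_; inj₁; inj₂; [_,_]′)
open import Data.List.Relation.Unary.All using (_∷_)
open import Data.Empty using (⊥-elim)
open import Function using (_∘_; id; _⇔_; mk⇔; Equivalence; case_of_)
open import Function.Construct.Symmetry using (⇔-sym)
open import Function.Construct.Composition using (_⇔-∘_)
open import Relation.Nullary using (¬_; Dec; yes; no; does)
open import Relation.Nullary.Decidable using (dec-true; dec-false; does-⇔; _×-dec_; _⊎-dec_; _→-dec_; ¬?)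
open import Relation.Unary using (Pred; Decidable)
open import Relation.Binary.PropositionalEquality
open import Relation.Binary.Definitions using (tri<; tri≈; tri>)
open import Algebra.Bundles using (Group)
import Algebra.Properties.Group as GroupProperties

open import Algebra.Properties.CommutativeSemigroup ℤP.*-commutativeSemigroup using (x∙yz≈y∙xz; xy∙z≈xz∙y)
open import Algebra.Properties.Semiring.Sum ℤP.+-*-semiring
  using (sum; sum-syntax; sum-cong-≗; sum-replicate-zero; ∑-comm; ∑-distrib-+; *-distribˡ-sum)

𝟙 : {A : Set} → Dec A → ℤ
𝟙 a? = if does a? then + 1 else + 0

𝟙-yes : {A : Set} (a? : Dec A) → A → 𝟙 a? ≡ + 1
𝟙-yes a? a rewrite dec-true a? a = refl

𝟙-no : {A : Set} (a? : Dec A) → ¬ A → 𝟙 a? ≡ + 0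
𝟙-no a? ¬a rewrite dec-false a? ¬a = refl

𝟙-⇔ : {A B : Set} → A ⇔ B → (a? : Dec A) (b? : Dec B) → 𝟙 a? ≡ 𝟙 b?
𝟙-⇔ A⇔B a? b? = cong (if_then + 1 else + 0) (does-⇔ A⇔B a? b?)

𝟙-× : {A B : Set} (a? : Dec A) (b? : Dec B) → 𝟙 (a? ×-dec b?) ≡ 𝟙 a? *ℤ 𝟙 b?
𝟙-× (yes _) (yes _) = refl
𝟙-× (yes _) (no _)  = refl
𝟙-× (no _)  (yes _) = refl
𝟙-× (no _)  (no _)  = refl

𝟙*-yes : {A : Set} (a? : Dec A) → A → ∀ y → 𝟙 a? *ℤ y ≡ y
𝟙*-yes a? a y rewrite dec-true a? a = ℤP.*-identityˡ y

𝟙*-no : {A : Set} (a? : Dec A) → ¬ A → ∀ y → 𝟙 a? *ℤ y ≡ + 0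
𝟙*-no a? ¬a y rewrite dec-false a? ¬a = refl

*𝟙-yes : {A : Set} (a? : Dec A) → A → ∀ x → x *ℤ 𝟙 a? ≡ x
*𝟙-yes a? a x = trans (cong (x *ℤ_) (𝟙-yes a? a)) (ℤP.*-identityʳ x)

*𝟙-no : {A : Set} (a? : Dec A) → ¬ A → ∀ x → x *ℤ 𝟙 a? ≡ + 0
*𝟙-no a? ¬a x = trans (cong (x *ℤ_) (𝟙-no a? ¬a)) (ℤP.*-zeroʳ x)

𝟙*-cong : {A : Set} (a? : Dec A) {y z : ℤ} → (A → y ≡ z) → 𝟙 a? *ℤ y ≡ 𝟙 a? *ℤ z
𝟙*-cong (yes a) eq = cong (+ 1 *ℤ_) (eq a)
𝟙*-cong (no _)  eq = refl

𝟙*-absorb : {A B : Set} (a? : Dec A) (b? : Dec B) → (A → B) → ∀ y → 𝟙 b? *ℤ (𝟙 a? *ℤ y) ≡ 𝟙 a? *ℤ y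
𝟙*-absorb (yes a) b? A⇒B y = 𝟙*-yes b? (A⇒B a) _
𝟙*-absorb (no _)  b? _   y = ℤP.*-zeroʳ (𝟙 b?)

𝟙-split : {A : Set} (a? : Dec A) (y : ℤ) → y ≡ 𝟙 a? *ℤ y +ℤ 𝟙 (¬? a?) *ℤ y
𝟙-split (yes _) y = sym (trans (cong₂ _+ℤ_ (ℤP.*-identityˡ y) (ℤP.*-zeroˡ y)) (ℤP.+-identityʳ y))
𝟙-split (no _)  y = sym (trans (cong₂ _+ℤ_ (ℤP.*-zeroˡ y) (ℤP.*-identityˡ y)) (ℤP.+-identityˡ y))

if-then-0 : {A : Set} (a? : Dec A) (y : ℤ) → (if does a? then y else + 0) ≡ 𝟙 a? *ℤ y
if-then-0 (yes _) y = sym (ℤP.*-identityˡ y)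
if-then-0 (no _)  y = refl

∑< : ℕ → (ℕ → ℤ) → ℤ
∑< zero    h = + 0
∑< (suc N) h = h 0 +ℤ ∑< N (h ∘ suc)

∑<≡∑ : ∀ N (h : ℕ → ℤ) → ∑< N h ≡ ∑[ i < N ] h (toℕ i)
∑<≡∑ zero    h = refl
∑<≡∑ (suc N) h = cong (h 0 +ℤ_) (∑<≡∑ N (h ∘ suc))

∑<-cong : ∀ N {h h′ : ℕ → ℤ} → (∀ k → k < N → h k ≡ h′ k) → ∑< N h ≡ ∑< N h′
∑<-cong zero    eq = refl
∑<-cong (suc N) eq = cong₂ _+ℤ_ (eq 0 (s≤s z≤n)) (∑<-cong N λ k k<N → eq (suc k) (s≤s k<N))

∑<-zero : ∀ N {h : ℕ → ℤ} → (∀ k → k < N → h k ≡ + 0) → ∑< N h ≡ + 0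
∑<-zero zero    eq = refl
∑<-zero (suc N) eq = cong₂ _+ℤ_ (eq 0 (s≤s z≤n)) (∑<-zero N λ k k<N → eq (suc k) (s≤s k<N))

∑<-distrib-+ : ∀ N (h h′ : ℕ → ℤ) → ∑< N (λ k → h k +ℤ h′ k) ≡ ∑< N h +ℤ ∑< N h′
∑<-distrib-+ N h h′ = begin
  ∑< N (λ k → h k +ℤ h′ k)                              ≡⟨ ∑<≡∑ N _ ⟩
  ∑[ i < N ] (h (toℕ i) +ℤ h′ (toℕ i))                  ≡⟨ ∑-distrib-+ {N} (h ∘ toℕ) (h′ ∘ toℕ) ⟩
  ∑[ i < N ] h (toℕ i) +ℤ ∑[ i < N ] h′ (toℕ i)         ≡⟨ cong₂ _+ℤ_ (∑<≡∑ N h) (∑<≡∑ N h′) ⟨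
  ∑< N h +ℤ ∑< N h′                                      ∎
  where open ≡-Reasoning

*-distribˡ-∑< : ∀ c N (h : ℕ → ℤ) → c *ℤ ∑< N h ≡ ∑< N (λ k → c *ℤ h k)
*-distribˡ-∑< c N h = begin
  c *ℤ ∑< N h                   ≡⟨ cong (c *ℤ_) (∑<≡∑ N h) ⟩
  c *ℤ ∑[ i < N ] h (toℕ i)     ≡⟨ *-distribˡ-sum {N} c (h ∘ toℕ) ⟩
  ∑[ i < N ] (c *ℤ h (toℕ i))   ≡⟨ ∑<≡∑ N _ ⟨
  ∑< N (λ k → c *ℤ h k)         ∎
  where open ≡-Reasoning

∑-∑< : ∀ n N (F : Fin n → ℕ → ℤ) → ∑[ x < n ] ∑< N (F x) ≡ ∑< N (λ k → ∑[ x < n ] F x k)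
∑-∑< n N F = begin
  ∑[ x < n ] ∑< N (F x)                     ≡⟨ sum-cong-≗ (λ x → ∑<≡∑ N (F x)) ⟩
  ∑[ x < n ] ∑[ i < N ] F x (toℕ i)         ≡⟨ ∑-comm {n} {N} (λ x i → F x (toℕ i)) ⟩
  ∑[ i < N ] ∑[ x < n ] F x (toℕ i)         ≡⟨ ∑<≡∑ N _ ⟨
  ∑< N (λ k → ∑[ x < n ] F x k)             ∎
  where open ≡-Reasoning

∑<-comm : ∀ M N (F : ℕ → ℕ → ℤ) → ∑< M (λ i → ∑< N (F i)) ≡ ∑< N (λ j → ∑< M (λ i → F i j))
∑<-comm M N F = begin
  ∑< M (λ i → ∑< N (F i))             ≡⟨ ∑<≡∑ M _ ⟩
  ∑[ i < M ] ∑< N (F (toℕ i))         ≡⟨ ∑-∑< M N (F ∘ toℕ) ⟩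
  ∑< N (λ j → ∑[ i < M ] F (toℕ i) j) ≡⟨ ∑<-cong N (λ j _ → ∑<≡∑ M (λ i → F i j)) ⟨
  ∑< N (λ j → ∑< M (λ i → F i j))     ∎
  where open ≡-Reasoning

∑-distrib-- : ∀ n (f g : Fin n → ℤ) → ∑[ x < n ] (f x - g x) ≡ ∑[ x < n ] f x - ∑[ x < n ] g x
∑-distrib-- n f g = trans (∑-distrib-+ f (λ x → - g x)) (cong (∑[ x < n ] f x +ℤ_) (begin
  ∑[ x < n ] (- g x)          ≡⟨ sum-cong-≗ (λ x → ℤP.-1*i≡-i (g x)) ⟨
  ∑[ x < n ] (ℤ.-1ℤ *ℤ g x)   ≡⟨ *-distribˡ-sum ℤ.-1ℤ g ⟨
  ℤ.-1ℤ *ℤ ∑[ x < n ] g x     ≡⟨ ℤP.-1*i≡-i _ ⟩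
  - ∑[ x < n ] g x            ∎))
  where open ≡-Reasoning

∑<-+ : ∀ M N (h : ℕ → ℤ) → ∑< (M + N) h ≡ ∑< M h +ℤ ∑< N (λ k → h (M + k))
∑<-+ zero    N h = sym (ℤP.+-identityˡ _)
∑<-+ (suc M) N h = trans (cong (h 0 +ℤ_) (∑<-+ M N (h ∘ suc))) (sym (ℤP.+-assoc (h 0) _ _))

∑<-single : ∀ N {h : ℕ → ℤ} k₀ → k₀ < N → (∀ k → k < N → k ≢ k₀ → h k ≡ + 0) → ∑< N h ≡ h k₀
∑<-single (suc N) {h} zero _ others =
  trans (cong (h 0 +ℤ_) (∑<-zero N (λ k k<N → others (suc k) (s≤s k<N) λ ())))
        (ℤP.+-identityʳ (h 0))
∑<-single (suc N) {h} (suc k₀) (s≤s k₀<N) others =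
  trans (cong (_+ℤ ∑< N (h ∘ suc)) (others 0 (s≤s z≤n) λ ()))
  (trans (ℤP.+-identityˡ _)
         (∑<-single N k₀ k₀<N λ k k<N k≢k₀ → others (suc k) (s≤s k<N) (k≢k₀ ∘ ℕP.suc-injective)))

∑<-truncate : ∀ {M N} {h : ℕ → ℤ} → M ≤ N → (∀ k → M ≤ k → k < N → h k ≡ + 0) → ∑< N h ≡ ∑< M h
∑<-truncate {zero}  {N}     _         tail = ∑<-zero N (λ k → tail k z≤n)
∑<-truncate {suc M} {suc N} {h} (s≤s M≤N) tail =
  cong (h 0 +ℤ_) (∑<-truncate M≤N (λ k M≤k k<N → tail (suc k) (s≤s M≤k) (s≤s k<N)))

foldr-+-map-upTo : ∀ N (h : ℕ → ℤ) → List.foldr _+ℤ_ (+ 0) (map h (upTo N)) ≡ ∑< N h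
foldr-+-map-upTo N h = trans (cong (List.foldr _+ℤ_ (+ 0)) (ListP.map-upTo h N)) (go N h)
  where
  go : ∀ N (h : ℕ → ℤ) → List.foldr _+ℤ_ (+ 0) (applyUpTo h N) ≡ ∑< N h
  go zero    h = refl
  go (suc N) h = cong (h 0 +ℤ_) (go N (h ∘ suc))

+length-filter : {A : Set} {P : Pred A 0ℓ} (P? : Decidable P) (xs : List A) →
  + length (filter P? xs) ≡ List.foldr _+ℤ_ (+ 0) (map (𝟙 ∘ P?) xs)
+length-filter P? []       = refl
+length-filter P? (x ∷ xs) with does (P? x)
... | true  = cong (+ 1 +ℤ_) (+length-filter P? xs)
... | false = trans (+length-filter P? xs) (sym (ℤP.+-identityˡ _))

count≡∑𝟙 : ∀ {n} {P : Pred (Fin n) 0ℓ} (P? : Decidable P) → + count P? ≡ ∑[ x < n ] 𝟙 (P? x)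
count≡∑𝟙 {n} P? = trans (+length-filter P? (List.allFin n))
  (trans (cong (List.foldr _+ℤ_ (+ 0)) (ListP.map-tabulate id (𝟙 ∘ P?))) (go (𝟙 ∘ P?)))
  where
  go : ∀ {m} (t : Fin m → ℤ) → List.foldr _+ℤ_ (+ 0) (tabulate t) ≡ sum t
  go {zero}  t = refl
  go {suc m} t = cong (t Fin.zero +ℤ_) (go (t ∘ Fin.suc))

count-none : ∀ {n} {P : Pred (Fin n) 0ℓ} (P? : Decidable P) → (∀ x → ¬ P x) → count P? ≡ 0
count-none {n} P? none = ℤP.+-injective (trans (count≡∑𝟙 P?)
  (trans (sum-cong-≗ λ x → 𝟙-no (P? x) (none x)) (sum-replicate-zero n)))

∑∣ : ℕ → (ℕ → ℕ → ℤ) → ℤ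
∑∣ r G = ∑< r (λ k → 𝟙 (suc k ∣? r) *ℤ G (suc k) (r / suc k))

divSumIf≡∑∣ : ∀ r c f → divSumIf r c f ≡ ∑∣ r (λ d q → if c d q then f d q else + 0)
divSumIf≡∑∣ r c f = trans (foldr-+-map-upTo r term)
  (∑<-cong r {h′ = λ k → 𝟙 (suc k ∣? r) *ℤ G (suc k) (r / suc k)} λ k _ → if-then-0 (suc k ∣? r) _)
  where
  G : ℕ → ℕ → ℤ
  G d q = if c d q then f d q else + 0
  term : ℕ → ℤ
  term k = if does (suc k ∣? r) then G (suc k) (r / suc k) else + 0

divSum≡∑∣ : ∀ r f → divSum r f ≡ ∑∣ r f
divSum≡∑∣ r f = divSumIf≡∑∣ r (λ _ _ → true) f

divSumIf-𝟙 : ∀ r {C : ℕ → ℕ → Set} (C? : ∀ d q → Dec (C d q)) f →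
  divSumIf r (λ d q → does (C? d q)) f ≡ ∑∣ r (λ d q → 𝟙 (C? d q) *ℤ f d q)
divSumIf-𝟙 r C? f = trans (divSumIf≡∑∣ r (λ d q → does (C? d q)) f) (∑<-cong r λ k _ →
  cong (𝟙 (suc k ∣? r) *ℤ_) (if-then-0 (C? (suc k) (r / suc k)) _))

∑∣-cong : ∀ r {G H : ℕ → ℕ → ℤ} → (∀ d q → r ≡ q * d → G d q ≡ H d q) → ∑∣ r G ≡ ∑∣ r H
∑∣-cong r eq = ∑<-cong r λ k _ → 𝟙*-cong (suc k ∣? r) λ k+1∣r →
  eq (suc k) (r / suc k) (sym (m/n*n≡m k+1∣r))

∑∣-zero : ∀ r {G : ℕ → ℕ → ℤ} → (∀ d q → r ≡ q * d → G d q ≡ + 0) → ∑∣ r G ≡ + 0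
∑∣-zero r eq = trans (∑∣-cong r {H = λ _ _ → + 0} eq) (∑<-zero r λ k _ → ℤP.*-zeroʳ (𝟙 (suc k ∣? r)))

∑∣-𝟙-⇔ : ∀ r (W : ℕ → ℕ → ℤ) {Q Q′ : ℕ → Set} (Q? : Decidable Q) (Q′? : Decidable Q′) →
  (∀ d → Q d ⇔ Q′ d) → ∑∣ r (λ d q → W d q *ℤ 𝟙 (Q? d)) ≡ ∑∣ r (λ d q → W d q *ℤ 𝟙 (Q′? d))
∑∣-𝟙-⇔ r W Q? Q′? Q⇔Q′ = ∑∣-cong r λ d q _ → cong (W d q *ℤ_) (𝟙-⇔ (Q⇔Q′ d) (Q? d) (Q′? d))

∑∣-𝟙-none : ∀ r (W : ℕ → ℕ → ℤ) {Q : ℕ → Set} (Q? : Decidable Q) →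
  (∀ d → ¬ Q d) → ∑∣ r (λ d q → W d q *ℤ 𝟙 (Q? d)) ≡ + 0
∑∣-𝟙-none r W Q? none = ∑∣-zero r λ d q _ → *𝟙-no (Q? d) (none d) (W d q)

∑∣-scale : ∀ r c (G : ℕ → ℕ → ℤ) → ∑∣ r (λ d q → c *ℤ G d q) ≡ c *ℤ ∑∣ r G
∑∣-scale r c G = trans (∑<-cong r λ k _ → x∙yz≈y∙xz (𝟙 (suc k ∣? r)) c (G (suc k) (r / suc k)))
                       (sym (*-distribˡ-∑< c r _))

∑∣-distrib-+ : ∀ r (G H : ℕ → ℕ → ℤ) → ∑∣ r (λ d q → G d q +ℤ H d q) ≡ ∑∣ r G +ℤ ∑∣ r H
∑∣-distrib-+ r G H = trans (∑<-cong r λ k _ → ℤP.*-distribˡ-+ (𝟙 (suc k ∣? r)) _ _) (∑<-distrib-+ r _ _)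

∑-∑∣ : ∀ n r (G : Fin n → ℕ → ℕ → ℤ) → ∑[ x < n ] ∑∣ r (G x) ≡ ∑∣ r (λ d q → ∑[ x < n ] G x d q)
∑-∑∣ n r G = trans (∑-∑< n r _) (∑<-cong r λ k _ → sym (*-distribˡ-sum {n} (𝟙 (suc k ∣? r)) _))

∑-∑∣-count : ∀ {n} r (W : ℕ → ℕ → ℤ) {Q : ℕ → Pred (Fin n) 0ℓ} (Q? : ∀ d → Decidable (Q d)) →
  ∑[ x < n ] ∑∣ r (λ d q → W d q *ℤ 𝟙 (Q? d x)) ≡ ∑∣ r (λ d q → W d q *ℤ + count (Q? d))
∑-∑∣-count {n} r W Q? = trans (∑-∑∣ n r (λ x d q → W d q *ℤ 𝟙 (Q? d x))) (∑∣-cong r λ d q _ →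
  trans (sym (*-distribˡ-sum (W d q) (λ x → 𝟙 (Q? d x)))) (cong (W d q *ℤ_) (sym (count≡∑𝟙 (Q? d)))))

+count-via-∑∣ : ∀ {n} r (W : ℕ → ℕ → ℤ) {P : Pred (Fin n) 0ℓ} (P? : Decidable P)
  {Q : ℕ → Pred (Fin n) 0ℓ} (Q? : ∀ d → Decidable (Q d)) →
  (∀ x → 𝟙 (P? x) ≡ ∑∣ r (λ d q → W d q *ℤ 𝟙 (Q? d x))) →
  + count P? ≡ ∑∣ r (λ d q → W d q *ℤ + count (Q? d))
+count-via-∑∣ r W P? Q? pointwise = trans (count≡∑𝟙 P?) (trans (sum-cong-≗ pointwise) (∑-∑∣-count r W Q?))

-- [0, m·p) splits into m blocks of length p, and the only k in a block with p ∣ k + 1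
-- is the last one.
∑<-multiples : ∀ p .{{_ : NonZero p}} m (H : ℕ → ℤ) →
  ∑< (m * p) (λ k → 𝟙 (p ∣? suc k) *ℤ H (suc k)) ≡ ∑< m (λ a → H (suc a * p))
∑<-multiples p         zero    H = refl
∑<-multiples p@(suc q) (suc m) H =
  trans (∑<-+ p (m * p) (λ k → 𝟙 (p ∣? suc k) *ℤ H (suc k))) (cong₂ _+ℤ_ firstBlock laterBlocks)
  where
  firstBlock : ∑< p (λ k → 𝟙 (p ∣? suc k) *ℤ H (suc k)) ≡ H (1 * p)
  firstBlock = begin
    ∑< p (λ k → 𝟙 (p ∣? suc k) *ℤ H (suc k)) ≡⟨ ∑<-single p q ℕP.≤-refl others ⟩
    𝟙 (p ∣? p) *ℤ H p                         ≡⟨ 𝟙*-yes (p ∣? p) ∣-refl (H p) ⟩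
    H p                                       ≡⟨ cong H (sym (ℕP.*-identityˡ p)) ⟩
    H (1 * p)                                 ∎
    where
    open ≡-Reasoning
    others : ∀ k → k < p → k ≢ q → 𝟙 (p ∣? suc k) *ℤ H (suc k) ≡ + 0
    others k k<p k≢q = 𝟙*-no (p ∣? suc k)
      (λ p∣k+1 → ℕP.<⇒≱ (s≤s (ℕP.≤∧≢⇒< (ℕP.≤-pred k<p) k≢q)) (∣⇒≤ p∣k+1)) _
  shift : ∀ k → p ∣ suc (p + k) ⇔ p ∣ suc k
  shift k = mk⇔ (λ h → ∣m+n∣m⇒∣n (subst (p ∣_) (sym (ℕP.+-suc p k)) h) ∣-refl)
                (λ h → subst (p ∣_) (ℕP.+-suc p k) (∣m∣n⇒∣m+n ∣-refl h))
  laterBlocks : ∑< (m * p) (λ k → 𝟙 (p ∣? suc (p + k)) *ℤ H (suc (p + k)))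
              ≡ ∑< m (λ a → H (suc (suc a) * p))
  laterBlocks = trans
    (∑<-cong (m * p) {h′ = λ k → 𝟙 (p ∣? suc k) *ℤ H (p + suc k)} λ k _ →
      cong₂ _*ℤ_ (𝟙-⇔ (shift k) (p ∣? suc (p + k)) (p ∣? suc k)) (cong H (sym (ℕP.+-suc p k))))
    (∑<-multiples p m (λ d → H (p + d)))

∑∣-multiples : ∀ p .{{_ : NonZero p}} m (G : ℕ → ℕ → ℤ) →
  ∑∣ (m * p) (λ d q → 𝟙 (p ∣? d) *ℤ G d q) ≡ ∑∣ m (λ e q → G (e * p) q)
∑∣-multiples p@(suc _) m G = begin
  ∑< (m * p) (λ k → 𝟙 (suc k ∣? m * p) *ℤ (𝟙 (p ∣? suc k) *ℤ G (suc k) (m * p / suc k)))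
    ≡⟨ ∑<-cong (m * p) (λ k _ → x∙yz≈y∙xz (𝟙 (suc k ∣? m * p)) (𝟙 (p ∣? suc k)) (G (suc k) (m * p / suc k))) ⟩
  ∑< (m * p) (λ k → 𝟙 (p ∣? suc k) *ℤ H (suc k))
    ≡⟨ ∑<-multiples p m H ⟩
  ∑< m (λ a → 𝟙 (suc a * p ∣? m * p) *ℤ G (suc a * p) (m * p / (suc a * p)))
    ≡⟨ ∑<-cong m (λ a _ → cong₂ _*ℤ_ (𝟙-⇔ (mk⇔ (*-cancelʳ-∣ p) (*-monoˡ-∣ p)) (suc a * p ∣? m * p) (suc a ∣? m))
                                    (cong (G (suc a * p)) (m*n/o*n≡m/o m p (suc a)))) ⟩
  ∑< m (λ a → 𝟙 (suc a ∣? m) *ℤ G (suc a * p) (m / suc a)) ∎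
  where
  open ≡-Reasoning
  H : ℕ → ℤ
  H zero      = + 0
  H d@(suc _) = 𝟙 (d ∣? m * p) *ℤ G d (m * p / d)

∑∣-divisors : ∀ {m r} .{{_ : NonZero r}} → m ∣ r → (g : ℕ → ℤ) →
  ∑∣ r (λ d _ → 𝟙 (d ∣? m) *ℤ g d) ≡ ∑∣ m (λ d _ → g d)
∑∣-divisors {m} {r} m∣r g = trans
  (∑<-cong r λ k _ → 𝟙*-absorb (suc k ∣? m) (suc k ∣? r) (λ k+1∣m → ∣-trans k+1∣m m∣r) _)
  (∑<-truncate (∣⇒≤ m∣r) λ k m≤k _ → 𝟙*-no (suc k ∣? m) (λ k+1∣m → ℕP.<⇒≱ (s≤s m≤k) (∣⇒≤ k+1∣m)) _)
  where
  instance
    m≢0 : NonZero m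
    m≢0 = ℕ.≢-nonZero λ { refl → ℕ.≢-nonZero⁻¹ r (0∣⇒≡0 m∣r) }

∑<-cofactor : ∀ d .{{_ : NonZero d}} r .{{_ : NonZero r}} (g : ℕ → ℤ) →
  ∑< r (λ j → 𝟙 (d * suc j ≟ r) *ℤ g (suc j)) ≡ 𝟙 (d ∣? r) *ℤ g (r / d)
∑<-cofactor d r g with d ∣? r
... | no d∤r = ∑<-zero r λ j _ →
  𝟙*-no (d * suc j ≟ r) (λ eq → d∤r (divides (suc j) (trans (sym eq) (ℕP.*-comm d (suc j))))) _
... | yes (divides zero r≡0) = ⊥-elim (ℕ.≢-nonZero⁻¹ r r≡0)
... | yes (divides (suc q) r≡[q+1]*d) = begin
  ∑< r (λ j → 𝟙 (d * suc j ≟ r) *ℤ g (suc j)) ≡⟨ ∑<-single r q q<r others ⟩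
  𝟙 (d * suc q ≟ r) *ℤ g (suc q)              ≡⟨ 𝟙*-yes (d * suc q ≟ r) d*[q+1]≡r (g (suc q)) ⟩
  g (suc q)                                    ≡⟨ cong g r/d≡q+1 ⟨
  g (r / d)                                    ≡⟨ ℤP.*-identityˡ (g (r / d)) ⟨
  + 1 *ℤ g (r / d)                             ∎
  where
  open ≡-Reasoning
  d*[q+1]≡r : d * suc q ≡ r
  d*[q+1]≡r = trans (ℕP.*-comm d (suc q)) (sym r≡[q+1]*d)
  r/d≡q+1 : r / d ≡ suc q
  r/d≡q+1 = trans (cong (_/ d) r≡[q+1]*d) (m*n/n≡m (suc q) d)
  q<r : q < r
  q<r = ℕP.≤-trans (ℕP.m≤m*n (suc q) d) (ℕP.≤-reflexive (sym r≡[q+1]*d))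
  others : ∀ j → j < r → j ≢ q → 𝟙 (d * suc j ≟ r) *ℤ g (suc j) ≡ + 0
  others j _ j≢q = 𝟙*-no (d * suc j ≟ r)
    (λ eq → j≢q (ℕP.suc-injective (ℕP.*-cancelˡ-≡ (suc j) (suc q) d (trans eq (sym d*[q+1]≡r))))) _

-- Both sides are the sum of G over the pairs (d, q) with d · q = r.
∑∣-flip : ∀ r (G : ℕ → ℕ → ℤ) → ∑∣ r G ≡ ∑∣ r (λ d q → G q d)
∑∣-flip zero      G = refl
∑∣-flip r@(suc _) G = begin
  ∑∣ r G                                        ≡⟨ as-pairs G ⟩
  ∑< r (λ i → ∑< r (pair G i))                  ≡⟨ ∑<-comm r r (pair G) ⟩
  ∑< r (λ j → ∑< r (λ i → pair G i j))
    ≡⟨ ∑<-cong r (λ j _ → ∑<-cong r λ i _ →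
         cong (λ n → 𝟙 (n ≟ r) *ℤ G (suc i) (suc j)) (ℕP.*-comm (suc i) (suc j))) ⟩
  ∑< r (λ j → ∑< r (pair (λ d q → G q d) j))    ≡⟨ as-pairs (λ d q → G q d) ⟨
  ∑∣ r (λ d q → G q d)                          ∎
  where
  open ≡-Reasoning
  pair : (ℕ → ℕ → ℤ) → ℕ → ℕ → ℤ
  pair H i j = 𝟙 (suc i * suc j ≟ r) *ℤ H (suc i) (suc j)
  as-pairs : ∀ H → ∑∣ r H ≡ ∑< r (λ i → ∑< r (pair H i))
  as-pairs H = ∑<-cong r λ i _ → sym (∑<-cofactor (suc i) r (H (suc i)))

SquareFree : ℕ → Set
SquareFree n = ∀ d → 2 ≤ d → ¬ (d * d ∣ n)

squareFree? : ∀ n → Dec (∀ (d : Fin (suc n)) → 2 ≤ toℕ d → ¬ (toℕ d * toℕ d ∣ n))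
squareFree? n = all? λ d → (2 ℕP.≤? toℕ d) →-dec ¬? ((toℕ d * toℕ d) ∣? n)

bounded-squareFree⇔ : ∀ n .{{_ : NonZero n}} →
  (∀ (d : Fin (suc n)) → 2 ≤ toℕ d → ¬ (toℕ d * toℕ d ∣ n)) ⇔ SquareFree n
bounded-squareFree⇔ n = mk⇔ to (λ sf d → sf (toℕ d))
  where
  to : (∀ (d : Fin (suc n)) → 2 ≤ toℕ d → ¬ (toℕ d * toℕ d ∣ n)) → SquareFree n
  to sf d 2≤d dd∣n = sf (Fin.fromℕ< (s≤s d≤n)) (subst (2 ≤_) (sym d≡) 2≤d)
                        (subst (λ k → k * k ∣ n) (sym d≡) dd∣n)
    where
    d≤n : d ≤ n
    d≤n = ℕP.≤-trans (ℕP.m≤m*n d d {{ℕ.>-nonZero (ℕP.≤-trans (s≤s z≤n) 2≤d)}}) (∣⇒≤ dd∣n)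
    d≡ : toℕ (Fin.fromℕ< (s≤s d≤n)) ≡ d
    d≡ = toℕ-fromℕ< (s≤s d≤n)

squarefree?-cong : ∀ m n .{{_ : NonZero m}} .{{_ : NonZero n}} →
  SquareFree m ⇔ SquareFree n → squarefree? m ≡ squarefree? n
squarefree?-cong m n m⇔n = does-⇔
  (⇔-sym (bounded-squareFree⇔ n) ⇔-∘ (m⇔n ⇔-∘ bounded-squareFree⇔ m)) (squareFree? m) (squareFree? n)

squarefree?-false : ∀ n .{{_ : NonZero n}} → ¬ SquareFree n → squarefree? n ≡ false
squarefree?-false n ¬sf = dec-false (squareFree? n) (¬sf ∘ Equivalence.to (bounded-squareFree⇔ n))

prime∤⇒coprime : ∀ {p d} → Prime p → ¬ p ∣ d → Coprime d p
prime∤⇒coprime pp p∤d (i∣d , i∣p) with prime⇒irreducible pp i∣p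
... | inj₁ i≡1 = i≡1
... | inj₂ refl = ⊥-elim (p∤d i∣d)

squareFree-*-prime : ∀ {p e} → Prime p → ¬ p ∣ e → SquareFree e ⇔ SquareFree (p * e)
squareFree-*-prime {p} {e} pp p∤e = mk⇔ to (λ sf d 2≤d dd∣e → sf d 2≤d (∣n⇒∣m*n p dd∣e))
  where
  instance _ = prime⇒nonZero pp
  to : SquareFree e → SquareFree (p * e)
  to sf d 2≤d dd∣pe with p ∣? d
  ... | yes p∣d = p∤e (*-cancelˡ-∣ p (∣-trans (*-pres-∣ p∣d p∣d) dd∣pe))
  ... | no  p∤d = sf d 2≤d (coprime-divisor (prime∤⇒coprime pp p∤dd) dd∣pe)
    where
    p∤dd : ¬ p ∣ d * d
    p∤dd p∣dd with euclidsLemma d d pp p∣dd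
    ... | inj₁ p∣d = p∤d p∣d
    ... | inj₂ p∣d = p∤d p∣d

+ω≡∑< : ∀ n → + ω n ≡ ∑< (suc n) (λ k → 𝟙 (prime? k ×-dec k ∣? n))
+ω≡∑< n = trans (+length-filter (λ k → prime? k ×-dec k ∣? n) (upTo (suc n)))
                (foldr-+-map-upTo (suc n) (λ k → 𝟙 (prime? k ×-dec k ∣? n)))

ω-*-prime : ∀ {p e} → Prime p → ¬ p ∣ e → .{{_ : NonZero e}} → ω (p * e) ≡ suc (ω e)
ω-*-prime {p} {e} pp p∤e = ℤP.+-injective (begin
  + ω (p * e)                                       ≡⟨ +ω≡∑< (p * e) ⟩
  ∑< (suc (p * e)) (λ k → 𝟙 (prime? k ×-dec k ∣? p * e))
    ≡⟨ ∑<-cong (suc (p * e)) (λ k _ → split k (k ≟ p)) ⟩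
  ∑< (suc (p * e)) (λ k → 𝟙 (k ≟ p) +ℤ 𝟙 (prime? k ×-dec k ∣? e))
    ≡⟨ ∑<-distrib-+ (suc (p * e)) (λ k → 𝟙 (k ≟ p)) (λ k → 𝟙 (prime? k ×-dec k ∣? e)) ⟩
  ∑< (suc (p * e)) (λ k → 𝟙 (k ≟ p)) +ℤ ∑< (suc (p * e)) (λ k → 𝟙 (prime? k ×-dec k ∣? e))
    ≡⟨ cong₂ _+ℤ_ (trans (∑<-single (suc (p * e)) p (s≤s p≤pe) (λ k _ → 𝟙-no (k ≟ p))) (𝟙-yes (p ≟ p) refl))
                  (∑<-truncate (s≤s e≤pe) λ k e<k _ →
                     𝟙-no (prime? k ×-dec k ∣? e) (λ (_ , k∣e) → ℕP.<⇒≱ e<k (∣⇒≤ k∣e))) ⟩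
  + 1 +ℤ ∑< (suc e) (λ k → 𝟙 (prime? k ×-dec k ∣? e)) ≡⟨ cong (+ 1 +ℤ_) (+ω≡∑< e) ⟨
  + suc (ω e)                                       ∎)
  where
  open ≡-Reasoning
  instance _ = prime⇒nonZero pp
  p≤pe : p ≤ p * e
  p≤pe = ℕP.m≤m*n p e
  e≤pe : e ≤ p * e
  e≤pe = ℕP.m≤n*m e p
  split : ∀ k → Dec (k ≡ p) →
    𝟙 (prime? k ×-dec k ∣? p * e) ≡ 𝟙 (k ≟ p) +ℤ 𝟙 (prime? k ×-dec k ∣? e)
  split k (yes refl) = begin
    𝟙 (prime? p ×-dec p ∣? p * e) ≡⟨ 𝟙-yes (prime? p ×-dec p ∣? p * e) (pp , ∣m⇒∣m*n e ∣-refl) ⟩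
    + 1
      ≡⟨ cong₂ _+ℤ_ (𝟙-yes (p ≟ p) refl) (𝟙-no (prime? p ×-dec p ∣? e) (p∤e ∘ proj₂)) ⟨
    𝟙 (p ≟ p) +ℤ 𝟙 (prime? p ×-dec p ∣? e) ∎
  split k (no k≢p) = begin
    𝟙 (prime? k ×-dec k ∣? p * e)
      ≡⟨ 𝟙-⇔ (mk⇔ to (λ (pk , k∣e) → pk , ∣n⇒∣m*n p k∣e)) (prime? k ×-dec k ∣? p * e) (prime? k ×-dec k ∣? e) ⟩
    𝟙 (prime? k ×-dec k ∣? e)      ≡⟨ ℤP.+-identityˡ _ ⟨
    + 0 +ℤ 𝟙 (prime? k ×-dec k ∣? e) ≡⟨ cong (_+ℤ 𝟙 (prime? k ×-dec k ∣? e)) (𝟙-no (k ≟ p) k≢p) ⟨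
    𝟙 (k ≟ p) +ℤ 𝟙 (prime? k ×-dec k ∣? e) ∎
    where
    to : Prime k × k ∣ p * e → Prime k × k ∣ e
    to (pk , k∣pe) with euclidsLemma p e pk k∣pe
    ... | inj₂ k∣e = pk , k∣e
    ... | inj₁ k∣p with prime⇒irreducible pp k∣p
    ...   | inj₁ refl = ⊥-elim (¬prime[1] pk)
    ...   | inj₂ k≡p  = ⊥-elim (k≢p k≡p)

μ-*-prime-∣ : ∀ {p e} → Prime p → p ∣ e → .{{_ : NonZero e}} → μ (p * e) ≡ + 0
μ-*-prime-∣ {p} {e} pp p∣e = cong (if_then ℤ.-1ℤ ℤ.^ ω (p * e) else + 0)
  (squarefree?-false (p * e) {{ℕP.m*n≢0 p e}} λ sf →
    sf p (ℕ.nonTrivial⇒n>1 p {{prime⇒nonTrivial pp}}) (*-monoʳ-∣ p p∣e))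
  where instance _ = prime⇒nonZero pp

μ-*-prime-∤ : ∀ {p e} → Prime p → ¬ p ∣ e → .{{_ : NonZero e}} → μ (p * e) ≡ - μ e
μ-*-prime-∤ {p} {e} pp p∤e = trans
  (cong₂ (λ b k → if b then ℤ.-1ℤ ℤ.^ k else + 0)
         (squarefree?-cong (p * e) e {{ℕP.m*n≢0 p e {{prime⇒nonZero pp}}}} (⇔-sym (squareFree-*-prime pp p∤e)))
         (ω-*-prime pp p∤e))
  (sign-flip (squarefree? e))
  where
  sign-flip : ∀ b → (if b then ℤ.-1ℤ ℤ.^ suc (ω e) else + 0) ≡ - (if b then ℤ.-1ℤ ℤ.^ ω e else + 0)
  sign-flip true  = ℤP.-1*i≡-i _
  sign-flip false = refl

-- Divisors of m·p divisible by p are the e·p with e ∣ m, and μ (e·p) is 0 if p ∣ e and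
-- - μ e otherwise; divisors not divisible by p divide m.  The two parts cancel.
∑∣μ-prime-multiple : ∀ {p} m → Prime p → .{{_ : NonZero m}} → ∑∣ (m * p) (λ d _ → μ d) ≡ + 0
∑∣μ-prime-multiple {p} m pp = begin
  ∑∣ (m * p) (λ d _ → μ d)
    ≡⟨ ∑∣-cong (m * p) (λ d _ _ → 𝟙-split (p ∣? d) (μ d)) ⟩
  ∑∣ (m * p) (λ d _ → 𝟙 (p ∣? d) *ℤ μ d +ℤ w d)
    ≡⟨ ∑∣-distrib-+ (m * p) (λ d _ → 𝟙 (p ∣? d) *ℤ μ d) (λ d _ → w d) ⟩
  ∑∣ (m * p) (λ d _ → 𝟙 (p ∣? d) *ℤ μ d) +ℤ ∑∣ (m * p) (λ d _ → w d)
    ≡⟨ cong₂ _+ℤ_ (∑∣-multiples p m (λ d _ → μ d)) coprime-part ⟩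
  ∑∣ m (λ e _ → μ (e * p)) +ℤ ∑∣ m (λ e _ → w e)
    ≡⟨ cong (_+ℤ ∑∣ m (λ e _ → w e)) (∑∣-cong m λ e q m≡qe → μ-multiple e q (p ∣? e) m≡qe) ⟩
  ∑∣ m (λ e _ → - w e) +ℤ ∑∣ m (λ e _ → w e)
    ≡⟨ ∑∣-distrib-+ m (λ e _ → - w e) (λ e _ → w e) ⟨
  ∑∣ m (λ e _ → - w e +ℤ w e)
    ≡⟨ ∑∣-zero m (λ e _ _ → ℤP.+-inverseˡ (w e)) ⟩
  + 0 ∎
  where
  open ≡-Reasoning
  instance _ = prime⇒nonZero pp
  w : ℕ → ℤ
  w d = 𝟙 (¬? (p ∣? d)) *ℤ μ d
  coprime-part : ∑∣ (m * p) (λ d _ → w d) ≡ ∑∣ m (λ d _ → w d)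
  coprime-part = trans
    (∑∣-cong (m * p) λ d q m*p≡q*d → sym (𝟙*-absorb (¬? (p ∣? d)) (d ∣? m)
      (λ p∤d → coprime-divisor (prime∤⇒coprime pp p∤d) (divides q (trans (ℕP.*-comm p m) m*p≡q*d))) (μ d)))
    (∑∣-divisors {m} {m * p} {{ℕP.m*n≢0 m p}} (m∣m*n p) w)
  μ-multiple : ∀ e q → Dec (p ∣ e) → m ≡ q * e → μ (e * p) ≡ - w e
  μ-multiple e q p∣e? m≡qe = trans (cong μ (ℕP.*-comm e p)) (go p∣e?)
    where
    instance
      e≢0 : NonZero e
      e≢0 = ℕ.≢-nonZero λ { refl → ℕ.≢-nonZero⁻¹ m (trans m≡qe (ℕP.*-zeroʳ q)) }
    go : Dec (p ∣ e) → μ (p * e) ≡ - w e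
    go (yes p∣e) = trans (μ-*-prime-∣ pp p∣e) (cong -_ (sym (𝟙*-no (¬? (p ∣? e)) (λ p∤e → p∤e p∣e) (μ e))))
    go (no  p∤e) = trans (μ-*-prime-∤ pp p∤e) (cong -_ (sym (𝟙*-yes (¬? (p ∣? e)) p∤e (μ e))))

∑∣μ : ∀ n .{{_ : NonZero n}} → ∑∣ n (λ d _ → μ d) ≡ 𝟙 (n ≟ 1)
∑∣μ 1 = refl
∑∣μ n@(suc (suc _)) with factorise n
... | record { factors = p ∷ ps ; isFactorisation = n≡p*m ; factorsPrime = pp ∷ psPrime } = begin
  ∑∣ n (λ d _ → μ d)       ≡⟨ cong (λ k → ∑∣ k (λ d _ → μ d)) (trans n≡p*m (ℕP.*-comm p _)) ⟩
  ∑∣ (m * p) (λ d _ → μ d) ≡⟨ ∑∣μ-prime-multiple m pp {{productOfPrimes≢0 psPrime}} ⟩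
  + 0                      ≡⟨ 𝟙-no (n ≟ 1) (λ ()) ⟨
  𝟙 (n ≟ 1)                ∎
  where
  open ≡-Reasoning
  m = product ps

∣-cofactor⇔ : ∀ {m p q d} .{{_ : NonZero p}} .{{d≢0 : NonZero d}} → m * p ≡ q * d → p ∣ q ⇔ d ∣ m
∣-cofactor⇔ {m} {p} {q} {d} mp≡qd = mk⇔
  (λ p∣q → *-cancelʳ-∣ p (subst₂ _∣_ (ℕP.*-comm p d) (sym mp≡qd) (*-monoˡ-∣ d p∣q)))
  (λ d∣m → *-cancelʳ-∣ d (subst₂ _∣_ (ℕP.*-comm d p) mp≡qd (*-monoˡ-∣ p d∣m)))

∑∣μ-divisible : ∀ p r .{{_ : NonZero p}} .{{_ : NonZero r}} →
  ∑∣ r (λ d q → μ q *ℤ 𝟙 (p ∣? d)) ≡ 𝟙 (p ≟ r)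
∑∣μ-divisible p r = trans (∑∣-flip r (λ d q → μ q *ℤ 𝟙 (p ∣? d))) (go (p ∣? r))
  where
  go : Dec (p ∣ r) → ∑∣ r (λ d q → μ d *ℤ 𝟙 (p ∣? q)) ≡ 𝟙 (p ≟ r)
  go (no p∤r) = trans
    (∑∣-zero r λ d q r≡qd →
      *𝟙-no (p ∣? q) (λ p∣q → p∤r (∣-trans p∣q (divides d (trans r≡qd (ℕP.*-comm q d))))) (μ d))
    (sym (𝟙-no (p ≟ r) λ p≡r → p∤r (∣-reflexive p≡r)))
  go (yes (divides m r≡mp)) = begin
    ∑∣ r (λ d q → μ d *ℤ 𝟙 (p ∣? q))
      ≡⟨ ∑∣-cong r (λ d q r≡qd → trans (ℤP.*-comm (μ d) (𝟙 (p ∣? q)))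
           (cong (_*ℤ μ d) (𝟙-⇔ (∣-cofactor⇔ {{d≢0 = d≢0 d q r≡qd}} (trans (sym r≡mp) r≡qd))
                                (p ∣? q) (d ∣? m)))) ⟩
    ∑∣ r (λ d _ → 𝟙 (d ∣? m) *ℤ μ d)
      ≡⟨ ∑∣-divisors (divides p (trans r≡mp (ℕP.*-comm m p))) μ ⟩
    ∑∣ m (λ d _ → μ d)
      ≡⟨ ∑∣μ m {{m≢0}} ⟩
    𝟙 (m ≟ 1)
      ≡⟨ 𝟙-⇔ (mk⇔ (λ { refl → sym (trans r≡mp (ℕP.*-identityˡ p)) })
                  (λ { refl → ℕP.*-cancelʳ-≡ m 1 p (trans (sym r≡mp) (sym (ℕP.*-identityˡ p))) }))
             (m ≟ 1) (p ≟ r) ⟩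
    𝟙 (p ≟ r) ∎
    where
    open ≡-Reasoning
    d≢0 : ∀ d q → r ≡ q * d → NonZero d
    d≢0 d q r≡qd = ℕ.≢-nonZero λ { refl → ℕ.≢-nonZero⁻¹ r (trans r≡qd (ℕP.*-zeroʳ q)) }
    m≢0 : NonZero m
    m≢0 = ℕ.≢-nonZero λ { refl → ℕ.≢-nonZero⁻¹ r r≡mp }

odd-cofactor⇔ : ∀ {m t q a} .{{_ : NonZero t}} → m ≡ q * a →
  (¬ 2 ∣ q × ¬ 2 * t ∣ a * t) ⇔ (¬ 2 ∣ m)
odd-cofactor⇔ {m} {t} {q} {a} m≡qa = mk⇔
  (λ (q-odd , 2t∤at) 2∣m → case euclidsLemma q a prime[2] (subst (2 ∣_) m≡qa 2∣m) of λ where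
     (inj₁ 2∣q) → q-odd 2∣q
     (inj₂ 2∣a) → 2t∤at (*-monoˡ-∣ t 2∣a))
  (λ m-odd → (λ 2∣q → m-odd (subst (2 ∣_) (sym m≡qa) (∣m⇒∣m*n a 2∣q)))
           , (λ 2t∣at → m-odd (subst (2 ∣_) (sym m≡qa) (∣n⇒∣m*n q (*-cancelʳ-∣ t 2t∣at)))))

odd-cofactor-weight : ∀ {m t q d} .{{_ : NonZero t}} → m * t ≡ q * d → Dec (t ∣ d) →
  𝟙 (¬? (2 ∣? q)) *ℤ μ q *ℤ 𝟙 (t ∣? d ×-dec ¬? (2 * t ∣? d)) ≡ 𝟙 (¬? (2 ∣? m)) *ℤ (μ q *ℤ 𝟙 (t ∣? d))
odd-cofactor-weight {m} {t} {q} {d} _ (no t∤d) = begin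
  𝟙 (¬? (2 ∣? q)) *ℤ μ q *ℤ 𝟙 (t ∣? d ×-dec ¬? (2 * t ∣? d))
    ≡⟨ *𝟙-no (t ∣? d ×-dec ¬? (2 * t ∣? d)) (t∤d ∘ proj₁) (𝟙 (¬? (2 ∣? q)) *ℤ μ q) ⟩
  + 0                               ≡⟨ ℤP.*-zeroʳ (𝟙 m-odd?) ⟨
  𝟙 m-odd? *ℤ + 0                   ≡⟨ cong (𝟙 m-odd? *ℤ_) (*𝟙-no (t ∣? d) t∤d (μ q)) ⟨
  𝟙 m-odd? *ℤ (μ q *ℤ 𝟙 (t ∣? d))   ∎
  where
  open ≡-Reasoning
  m-odd? = ¬? (2 ∣? m)
odd-cofactor-weight {m} {t} {q} {d} mt≡qd (yes t∣d@(divides a d≡at)) = begin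
  𝟙 q-odd? *ℤ μ q *ℤ 𝟙 (t ∣? d ×-dec ¬? (2 * t ∣? d))
    ≡⟨ cong (𝟙 q-odd? *ℤ μ q *ℤ_)
            (𝟙-⇔ (mk⇔ proj₂ (t∣d ,_)) (t ∣? d ×-dec ¬? (2 * t ∣? d)) (¬? (2 * t ∣? d))) ⟩
  𝟙 q-odd? *ℤ μ q *ℤ 𝟙 (¬? (2 * t ∣? d))
    ≡⟨ xy∙z≈xz∙y (𝟙 q-odd?) (μ q) (𝟙 (¬? (2 * t ∣? d))) ⟩
  𝟙 q-odd? *ℤ 𝟙 (¬? (2 * t ∣? d)) *ℤ μ q
    ≡⟨ cong (_*ℤ μ q) (𝟙-× q-odd? (¬? (2 * t ∣? d))) ⟨
  𝟙 (q-odd? ×-dec ¬? (2 * t ∣? d)) *ℤ μ q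
    ≡⟨ cong (_*ℤ μ q) (𝟙-⇔ (subst (λ n → (¬ 2 ∣ q × ¬ 2 * t ∣ n) ⇔ (¬ 2 ∣ m)) (sym d≡at)
                                   (odd-cofactor⇔ m≡qa))
                            (q-odd? ×-dec ¬? (2 * t ∣? d)) m-odd?) ⟩
  𝟙 m-odd? *ℤ μ q
    ≡⟨ cong (𝟙 m-odd? *ℤ_) (*𝟙-yes (t ∣? d) t∣d (μ q)) ⟨
  𝟙 m-odd? *ℤ (μ q *ℤ 𝟙 (t ∣? d)) ∎
  where
  open ≡-Reasoning
  q-odd? = ¬? (2 ∣? q)
  m-odd? = ¬? (2 ∣? m)
  m≡qa : m ≡ q * a
  m≡qa = ℕP.*-cancelʳ-≡ m (q * a) t (begin
    m * t       ≡⟨ mt≡qd ⟩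
    q * d       ≡⟨ cong (q *_) d≡at ⟩
    q * (a * t) ≡⟨ ℕP.*-assoc q a t ⟨
    q * a * t   ∎)

-- Writing r = m·t, every term is [m odd] times the corresponding term of ∑∣μ-divisible,
-- so the sum is [m odd]·[t = r] = [t = r].
∑∣μ-odd : ∀ t r .{{_ : NonZero t}} .{{_ : NonZero r}} →
  ∑∣ r (λ d q → 𝟙 (¬? (2 ∣? q)) *ℤ μ q *ℤ 𝟙 (t ∣? d ×-dec ¬? (2 * t ∣? d))) ≡ 𝟙 (t ≟ r)
∑∣μ-odd t r with t ∣? r
... | no t∤r = trans
  (∑∣-zero r λ d q r≡qd → *𝟙-no (t ∣? d ×-dec ¬? (2 * t ∣? d))
     (λ (t∣d , _) → t∤r (∣-trans t∣d (divides q r≡qd))) (𝟙 (¬? (2 ∣? q)) *ℤ μ q))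
  (sym (𝟙-no (t ≟ r) (t∤r ∘ ∣-reflexive)))
... | yes (divides m r≡mt) = begin
  ∑∣ r (λ d q → 𝟙 (¬? (2 ∣? q)) *ℤ μ q *ℤ 𝟙 (t ∣? d ×-dec ¬? (2 * t ∣? d)))
    ≡⟨ ∑∣-cong r (λ d q r≡qd → odd-cofactor-weight {m} {t} {q} {d} (trans (sym r≡mt) r≡qd) (t ∣? d)) ⟩
  ∑∣ r (λ d q → 𝟙 m-odd? *ℤ (μ q *ℤ 𝟙 (t ∣? d)))
    ≡⟨ ∑∣-scale r (𝟙 m-odd?) (λ d q → μ q *ℤ 𝟙 (t ∣? d)) ⟩
  𝟙 m-odd? *ℤ ∑∣ r (λ d q → μ q *ℤ 𝟙 (t ∣? d))
    ≡⟨ cong (𝟙 m-odd? *ℤ_) (∑∣μ-divisible t r) ⟩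
  𝟙 m-odd? *ℤ 𝟙 (t ≟ r)
    ≡⟨ 𝟙-× m-odd? (t ≟ r) ⟨
  𝟙 (m-odd? ×-dec t ≟ r)
    ≡⟨ 𝟙-⇔ (mk⇔ proj₂ λ t≡r → t≡r⇒m-odd t≡r , t≡r) (m-odd? ×-dec t ≟ r) (t ≟ r) ⟩
  𝟙 (t ≟ r) ∎
  where
  open ≡-Reasoning
  m-odd? = ¬? (2 ∣? m)
  t≡r⇒m-odd : t ≡ r → ¬ 2 ∣ m
  t≡r⇒m-odd refl 2∣m with ℕP.*-cancelʳ-≡ m 1 t (trans (sym r≡mt) (sym (ℕP.*-identityˡ t)))
  ... | refl = case ∣1⇒≡1 2∣m of λ ()
∀-Fin⇔∀-< : ∀ {m} (P : ℕ → Set) → (∀ (l : Fin m) → P (toℕ l)) ⇔ (∀ l → l < m → P l)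
∀-Fin⇔∀-< P = mk⇔ (λ h l l<m → subst P (toℕ-fromℕ< l<m) (h (Fin.fromℕ< l<m)))
                  (λ h l → h (toℕ l) (toℕ<n l))

Least : (ℕ → Set) → ℕ → Set
Least P m = P m × (∀ k → k < m → ¬ P k)

least-below : {P : ℕ → Set} → (∀ k → Dec (P k)) → ∀ N → (∀ k → k < N → ¬ P k) ⊎ Σ ℕ (Least P)
least-below P? zero = inj₁ λ _ ()
least-below P? (suc N) with least-below P? N
... | inj₂ found = inj₂ found
... | inj₁ none with P? N
...   | yes pN = inj₂ (N , pN , none)
...   | no ¬pN = inj₁ λ k k<1+N → [ none k , (λ { refl → ¬pN }) ]′ (ℕP.m<1+n⇒m<n∨m≡n k<1+N)

least : {P : ℕ → Set} → (∀ k → Dec (P k)) → ∀ {N} → P N → Σ ℕ (Least P)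
least P? {N} pN with least-below P? (suc N)
... | inj₁ none  = ⊥-elim (none N ℕP.≤-refl pN)
... | inj₂ found = found

iter-+ : ∀ {n} (f : Fin n → Fin n) a b x → iter f (a + b) x ≡ iter f a (iter f b x)
iter-+ f zero    b x = refl
iter-+ f (suc a) b x = cong f (iter-+ f a b x)

iter-comm : ∀ {n} (f g : Fin n → Fin n) → (∀ y → f (g y) ≡ g (f y)) →
  ∀ k y → iter f k (g y) ≡ g (iter f k y)
iter-comm f g f∘g≗g∘f zero    y = refl
iter-comm f g f∘g≗g∘f (suc k) y = trans (cong f (iter-comm f g f∘g≗g∘f k y)) (f∘g≗g∘f (iter f k y))

2∣⇒¬2∣suc : ∀ q → 2 ∣ q → ¬ 2 ∣ suc q
2∣⇒¬2∣suc q 2∣q 2∣q+1 with ∣1⇒≡1 (∣m+n∣m⇒∣n (subst (2 ∣_) (ℕP.+-comm 1 q) 2∣q+1) 2∣q)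
... | ()

iter-involution : ∀ {n} (ι : Fin n → Fin n) → (∀ y → ι (ι y) ≡ y) →
  ∀ q y → (2 ∣ q × iter ι q y ≡ y) ⊎ (2 ∣ suc q × iter ι q y ≡ ι y)
iter-involution ι ι-involutive zero    y = inj₁ (2 ∣0 , refl)
iter-involution ι ι-involutive (suc q) y with iter-involution ι ι-involutive q y
... | inj₁ (2∣q , ι^q≡id)   = inj₂ (∣m∣n⇒∣m+n ∣-refl 2∣q , cong ι ι^q≡id)
... | inj₂ (2∣q+1 , ι^q≡ι) = inj₁ (2∣q+1 , trans (cong ι ι^q≡ι) (ι-involutive y))

-- τ is the first time the f-orbit of x meets {x, ι x}.  Writing f^τ x = ι^b x, we get
-- f^(qτ + s) x = ι^(qb) (f^s x), so the orbit returns to {x, ι x} exactly at multiples of τ.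
module FirstReturn {n} (f ι : Fin n → Fin n)
  (ι-involutive : ∀ y → ι (ι y) ≡ y) (f∘ι≗ι∘f : ∀ y → f (ι y) ≡ ι (f y))
  (x : Fin n) {o : ℕ} (o-pos : 1 ≤ o) (f^o-fixes : iter f o x ≡ x) where

  Near : Fin n → Set
  Near y = y ≡ x ⊎ y ≡ ι x

  Returns : ℕ → Set
  Returns l = Near (iter f l x)

  NoReturnBefore : ℕ → Set
  NoReturnBefore m = ∀ l → 1 ≤ l → l < m → ¬ Returns l

  private
    first : Σ ℕ (Least (λ l → 1 ≤ l × Returns l))
    first = least (λ l → (1 ℕP.≤? l) ×-dec (iter f l x ≟ᶠ x ⊎-dec iter f l x ≟ᶠ ι x))
                  (o-pos , inj₁ f^o-fixes)

  τ : ℕ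
  τ = proj₁ first

  τ-pos : 1 ≤ τ
  τ-pos = proj₁ (proj₁ (proj₂ first))

  τ-returns : Returns τ
  τ-returns = proj₂ (proj₁ (proj₂ first))

  τ-first : NoReturnBefore τ
  τ-first l 1≤l l<τ ret = proj₂ (proj₂ first) l l<τ (1≤l , ret)

  first-return : ∀ {r} → 1 ≤ r → Returns r → NoReturnBefore r → r ≡ τ
  first-return {r} 1≤r ret early with ℕP.<-cmp r τ
  ... | tri< r<τ _ _ = ⊥-elim (τ-first r 1≤r r<τ ret)
  ... | tri≈ _ r≡τ _ = r≡τ
  ... | tri> _ _ τ<r = ⊥-elim (early τ τ-pos τ<r τ-returns)

  near-ι^ : ∀ k {y} → Near (iter ι k y) → Near y
  near-ι^ zero    = id
  near-ι^ (suc k) = near-ι^ k ∘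
    [ (λ ιy≡x → inj₂ (flip-ι ιy≡x)) , (λ ιy≡ιx → inj₁ (trans (flip-ι ιy≡ιx) (ι-involutive x))) ]′
    where
    flip-ι : ∀ {y z} → ι y ≡ z → y ≡ ι z
    flip-ι {y} ιy≡z = trans (sym (ι-involutive y)) (cong ι ιy≡z)

  f∘ι^≗ι^∘f : ∀ k y → f (iter ι k y) ≡ iter ι k (f y)
  f∘ι^≗ι^∘f k y = sym (iter-comm ι f (λ z → sym (f∘ι≗ι∘f z)) k y)

  iter-multiple : ∀ {b} → iter f τ x ≡ iter ι b x → ∀ q → iter f (q * τ) x ≡ iter ι (q * b) x
  iter-multiple {b} f^τ≡ι^b zero    = refl
  iter-multiple {b} f^τ≡ι^b (suc q) = begin
    iter f (τ + q * τ) x         ≡⟨ iter-+ f τ (q * τ) x ⟩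
    iter f τ (iter f (q * τ) x)  ≡⟨ cong (iter f τ) (iter-multiple f^τ≡ι^b q) ⟩
    iter f τ (iter ι (q * b) x)  ≡⟨ iter-comm f (iter ι (q * b)) (f∘ι^≗ι^∘f (q * b)) τ x ⟩
    iter ι (q * b) (iter f τ x)  ≡⟨ cong (iter ι (q * b)) f^τ≡ι^b ⟩
    iter ι (q * b) (iter ι b x)  ≡⟨ iter-+ ι (q * b) b x ⟨
    iter ι (q * b + b) x         ≡⟨ cong (λ k → iter ι k x) (ℕP.+-comm (q * b) b) ⟩
    iter ι (b + q * b) x         ∎
    where open ≡-Reasoning

  returns⇒τ∣ : ∀ {d} → Returns d → τ ∣ d
  returns⇒τ∣ {d} ret = m%n≡0⇒n∣m d τ (no-early-return (d % τ) (m%n<n d τ) remainder-returns)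
    where
    instance _ = ℕ.>-nonZero τ-pos
    twist : Σ ℕ λ b → iter f τ x ≡ iter ι b x
    twist = [ (λ fixed → 0 , fixed) , (λ inverted → 1 , inverted) ]′ τ-returns
    b = proj₁ twist
    remainder-returns : Returns (d % τ)
    remainder-returns = near-ι^ (d / τ * b) (subst Near (begin
      iter f d x                             ≡⟨ cong (λ k → iter f k x) (m≡m%n+[m/n]*n d τ) ⟩
      iter f (d % τ + d / τ * τ) x           ≡⟨ iter-+ f (d % τ) (d / τ * τ) x ⟩
      iter f (d % τ) (iter f (d / τ * τ) x)  ≡⟨ cong (iter f (d % τ)) (iter-multiple (proj₂ twist) (d / τ)) ⟩
      iter f (d % τ) (iter ι (d / τ * b) x)
        ≡⟨ iter-comm f (iter ι (d / τ * b)) (f∘ι^≗ι^∘f (d / τ * b)) (d % τ) x ⟩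
      iter ι (d / τ * b) (iter f (d % τ) x)  ∎) ret)
      where open ≡-Reasoning
    no-early-return : ∀ s → s < τ → Returns s → s ≡ 0
    no-early-return zero    _   _   = refl
    no-early-return (suc s) s<τ ret = ⊥-elim (τ-first (suc s) (s≤s z≤n) s<τ ret)

  module Fixing (τ-fixes : iter f τ x ≡ x) where

    fixes⇔ : ∀ d → iter f d x ≡ x ⇔ τ ∣ d
    fixes⇔ d = mk⇔ (returns⇒τ∣ ∘ inj₁) λ { (divides q refl) →
      trans (iter-multiple {0} τ-fixes q) (cong (λ k → iter ι k x) (ℕP.*-zeroʳ q)) }

    never-inverts : ι x ≢ x → ∀ d → iter f d x ≢ ι x
    never-inverts ιx≢x d f^d≡ιx =
      ιx≢x (trans (sym f^d≡ιx) (Equivalence.from (fixes⇔ d) (returns⇒τ∣ (inj₂ f^d≡ιx))))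

  module Inverting (τ-inverts : iter f τ x ≡ ι x) (ιx≢x : ι x ≢ x) where

    private
      at-multiple : ∀ q → iter f (q * τ) x ≡ iter ι q x
      at-multiple q = trans (iter-multiple {1} τ-inverts q) (cong (λ k → iter ι k x) (ℕP.*-identityʳ q))

      ι^-fixes⇔ : ∀ q → iter ι q x ≡ x ⇔ 2 ∣ q
      ι^-fixes⇔ q with iter-involution ι ι-involutive q x
      ... | inj₁ (2∣q , ι^q≡id) = mk⇔ (λ _ → 2∣q) (λ _ → ι^q≡id)
      ... | inj₂ (2∣q+1 , ι^q≡ι) = mk⇔ (λ ι^q≡id → ⊥-elim (ιx≢x (trans (sym ι^q≡ι) ι^q≡id)))
                                       (λ 2∣q → ⊥-elim (2∣⇒¬2∣suc q 2∣q 2∣q+1))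

      doubled⇔ : ∀ {d q} → d ≡ q * τ → 2 * τ ∣ d ⇔ 2 ∣ q
      doubled⇔ {d} {q} d≡qτ = mk⇔ (λ 2τ∣d → *-cancelʳ-∣ τ {{ℕ.>-nonZero τ-pos}} (subst (2 * τ ∣_) d≡qτ 2τ∣d))
                                  (λ 2∣q → subst (2 * τ ∣_) (sym d≡qτ) (*-monoˡ-∣ τ 2∣q))

    fixes⇔ : ∀ d → iter f d x ≡ x ⇔ 2 * τ ∣ d
    fixes⇔ d = mk⇔ to from
      where
      to : iter f d x ≡ x → 2 * τ ∣ d
      to f^d≡x with returns⇒τ∣ (inj₁ f^d≡x)
      ... | divides q d≡qτ = Equivalence.from (doubled⇔ d≡qτ) (Equivalence.to (ι^-fixes⇔ q)
        (trans (sym (at-multiple q)) (subst (λ k → iter f k x ≡ x) d≡qτ f^d≡x)))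
      from : 2 * τ ∣ d → iter f d x ≡ x
      from 2τ∣d with m*n∣⇒n∣ 2 τ 2τ∣d
      ... | divides q refl = trans (at-multiple q)
        (Equivalence.from (ι^-fixes⇔ q) (Equivalence.to (doubled⇔ refl) 2τ∣d))

    inverts⇔ : ∀ d → iter f d x ≡ ι x ⇔ (τ ∣ d × ¬ 2 * τ ∣ d)
    inverts⇔ d = mk⇔
      (λ f^d≡ιx → returns⇒τ∣ (inj₂ f^d≡ιx) ,
                  λ 2τ∣d → ιx≢x (trans (sym f^d≡ιx) (Equivalence.from (fixes⇔ d) 2τ∣d)))
      λ { (divides q refl , 2τ∤d) →
            trans (at-multiple q) (odd-power q (2τ∤d ∘ Equivalence.from (doubled⇔ refl))) }
      where
      odd-power : ∀ q → ¬ 2 ∣ q → iter ι q x ≡ ι x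
      odd-power q 2∤q with iter-involution ι ι-involutive q x
      ... | inj₁ (2∣q , _) = ⊥-elim (2∤q 2∣q)
      ... | inj₂ (_ , ι^q≡ι) = ι^q≡ι

μ-of-cofactor odd-μ-of-cofactor : ℕ → ℕ → ℤ
μ-of-cofactor     _ q = μ q
odd-μ-of-cofactor _ q = 𝟙 (¬? (2 ∣? q)) *ℤ μ q

module Orbits (A : FiniteGroup) (α : Fin (FiniteGroup.n A) → Fin (FiniteGroup.n A))
  (aut : IsAutomorphism A α) {o : ℕ} (ord : IsOrderOf α o)
  (S : Pred (Fin (FiniteGroup.n A)) 0ℓ) (S? : Decidable S) where

  open FiniteGroup A
  open Sets A α S S?
  open IsAutomorphism aut using (hom)
  open IsOrderOf ord using (pos; id-at-o)

  private
    group : Group 0ℓ 0ℓ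
    group = record { isGroup = isGroup }

  open Group group using (inverseˡ)
  open GroupProperties group using (⁻¹-involutive; inverseˡ-unique; identityˡ-unique)

  α-e : α e ≡ e
  α-e = identityˡ-unique (α e) (α e) (trans (sym (hom e e)) (cong α (Group.identityˡ group e)))

  α-⁻¹ : ∀ y → α (y ⁻¹) ≡ α y ⁻¹
  α-⁻¹ y = inverseˡ-unique (α (y ⁻¹)) (α y) (trans (sym (hom (y ⁻¹) y)) (trans (cong α (inverseˡ y)) α-e))

  module Orbit (x : Fin n) = FirstReturn α _⁻¹ ⁻¹-involutive α-⁻¹ x pos (id-at-o x)

  noEarly⇔ : ∀ m x → NoEarly m x ⇔ Orbit.NoReturnBefore x m
  noEarly⇔ m x = mk⇔
    (λ h l 1≤l l<m → let (¬fixed , ¬inverted) = to h l l<m 1≤l in [ ¬fixed , ¬inverted ]′)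
    (λ h → from λ l l<m 1≤l → (h l 1≤l l<m ∘ inj₁) , (h l 1≤l l<m ∘ inj₂))
    where open Equivalence (∀-Fin⇔∀-< {m} λ l → 1 ≤ l → ¬ (iter α l x ≡ x) × ¬ (iter α l x ≡ x ⁻¹))

  noEarlyFix⇔ : ∀ m x → x ⁻¹ ≡ x → NoEarlyFix m x ⇔ Orbit.NoReturnBefore x m
  noEarlyFix⇔ m x x⁻¹≡x = mk⇔
    (λ h l 1≤l l<m → [ to h l l<m 1≤l , (λ f^l≡x⁻¹ → to h l l<m 1≤l (trans f^l≡x⁻¹ x⁻¹≡x)) ]′)
    (λ h → from λ l l<m 1≤l → h l 1≤l l<m ∘ inj₁)
    where open Equivalence (∀-Fin⇔∀-< {m} λ l → 1 ≤ l → ¬ (iter α l x ≡ x))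

  record FixingOrbit (x : Fin n) : Set where
    field
      τ     : ℕ
      τ-pos : 1 ≤ τ
      τ∣o   : τ ∣ o
      FF⇔   : ∀ d → FF d x ⇔ τ ∣ d
      F⇔    : ∀ {r} → 1 ≤ r → F r x ⇔ τ ≡ r
      ¬I    : ∀ r → ¬ I r x
      ¬II   : ∀ d → ¬ II d x

  record InvertingOrbit (x : Fin n) : Set where
    field
      τ     : ℕ
      τ-pos : 1 ≤ τ
      2τ∣o  : 2 * τ ∣ o
      FF⇔   : ∀ d → FF d x ⇔ 2 * τ ∣ d
      ¬F    : ∀ {r} → 1 ≤ r → ¬ F r x
      I⇔    : ∀ {r} → 1 ≤ r → I r x ⇔ τ ≡ r
      II⇔   : ∀ d → II d x ⇔ (τ ∣ d × ¬ 2 * τ ∣ d)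

  data Shape (x : Fin n) : Set where
    outside   : ¬ (S x × ¬ x ⁻¹ ≡ x) → Shape x
    fixing    : FixingOrbit x → Shape x
    inverting : InvertingOrbit x → Shape x

  shape : ∀ x → Shape x
  shape x with S? x ×-dec ¬? (x ⁻¹ ≟ᶠ x)
  ... | no out = outside out
  ... | yes (x∈S , x⁻¹≢x) = [ fixing ∘ fixingOrbit , inverting ∘ invertingOrbit ]′ τ-returns
    where
    open Orbit x
    open Equivalence
    returns-first : ∀ {r} → 1 ≤ r → Returns r → NoEarly r x → τ ≡ r
    returns-first 1≤r ret early = sym (first-return 1≤r ret (to (noEarly⇔ _ x) early))
    fixingOrbit : iter α τ x ≡ x → FixingOrbit x
    fixingOrbit τ-fixes = record
      { τ     = τ
      ; τ-pos = τ-pos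
      ; τ∣o   = returns⇒τ∣ (inj₁ (id-at-o x))
      ; FF⇔   = λ d → mk⇔ (λ (_ , f^d≡x , _) → to (fixes⇔ d) f^d≡x)
                           (λ τ∣d → x∈S , from (fixes⇔ d) τ∣d , x⁻¹≢x)
      ; F⇔    = λ 1≤r → mk⇔ (λ (_ , _ , f^r≡x , early) → returns-first 1≤r (inj₁ f^r≡x) early)
                             λ { refl → x∈S , x⁻¹≢x ∘ sym , τ-fixes , from (noEarly⇔ τ x) τ-first }
      ; ¬I    = λ r (_ , _ , f^r≡x⁻¹ , _) → never-inverts x⁻¹≢x r f^r≡x⁻¹
      ; ¬II   = λ d (_ , f^d≡x⁻¹ , _) → never-inverts x⁻¹≢x d f^d≡x⁻¹
      }
      where open Fixing τ-fixes
    invertingOrbit : iter α τ x ≡ x ⁻¹ → InvertingOrbit x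
    invertingOrbit τ-inverts = record
      { τ     = τ
      ; τ-pos = τ-pos
      ; 2τ∣o  = to (fixes⇔ o) (id-at-o x)
      ; FF⇔   = λ d → mk⇔ (λ (_ , f^d≡x , _) → to (fixes⇔ d) f^d≡x)
                           (λ 2τ∣d → x∈S , from (fixes⇔ d) 2τ∣d , x⁻¹≢x)
      ; ¬F    = λ 1≤r (_ , _ , f^r≡x , early) → x⁻¹≢x (trans (sym τ-inverts)
                  (subst (λ k → iter α k x ≡ x) (sym (returns-first 1≤r (inj₁ f^r≡x) early)) f^r≡x))
      ; I⇔    = λ 1≤r → mk⇔ (λ (_ , _ , f^r≡x⁻¹ , early) → returns-first 1≤r (inj₂ f^r≡x⁻¹) early)
                             λ { refl → x∈S , x⁻¹≢x ∘ sym , τ-inverts , from (noEarly⇔ τ x) τ-first }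
      ; II⇔   = λ d → mk⇔ (λ (_ , f^d≡x⁻¹ , _) → to (inverts⇔ d) f^d≡x⁻¹)
                           (λ inverts → x∈S , from (inverts⇔ d) inverts , x⁻¹≢x)
      }
      where open Inverting τ-inverts x⁻¹≢x

  record InvolutionOrbit (x : Fin n) : Set where
    field
      τ     : ℕ
      τ-pos : 1 ≤ τ
      τ∣o   : τ ∣ o
      FFo⇔  : ∀ d → FFo d x ⇔ τ ∣ d
      Fo⇔   : ∀ {r} → 1 ≤ r → Fo r x ⇔ τ ≡ r

  involution? : ∀ x → ¬ (S x × x ⁻¹ ≡ x × ¬ x ≡ e) ⊎ InvolutionOrbit x
  involution? x with S? x ×-dec (x ⁻¹ ≟ᶠ x) ×-dec ¬? (x ≟ᶠ e)
  ... | no out = inj₁ out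
  ... | yes (x∈S , x⁻¹≡x , x≢e) = inj₂ record
    { τ     = τ
    ; τ-pos = τ-pos
    ; τ∣o   = returns⇒τ∣ (inj₁ (id-at-o x))
    ; FFo⇔  = λ d → mk⇔ (λ (_ , f^d≡x , _) → to (fixes⇔ d) f^d≡x)
                         (λ τ∣d → x∈S , from (fixes⇔ d) τ∣d , x⁻¹≡x , x≢e)
    ; Fo⇔   = λ 1≤r → mk⇔
        (λ (_ , _ , _ , f^r≡x , early) → sym (first-return 1≤r (inj₁ f^r≡x) (to (noEarlyFix⇔ _ x x⁻¹≡x) early)))
        λ { refl → x∈S , x⁻¹≡x , x≢e , τ-fixes , from (noEarlyFix⇔ τ x x⁻¹≡x) τ-first }
    }
    where
    open Orbit x
    τ-fixes : iter α τ x ≡ x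
    τ-fixes = [ id , (λ f^τ≡x⁻¹ → trans f^τ≡x⁻¹ x⁻¹≡x) ]′ τ-returns
    open Fixing τ-fixes
    open Equivalence

  module PointwiseCounts {r : ℕ} (1≤r : 1 ≤ r) where

    private
      instance _ = ℕ.>-nonZero 1≤r

      outside-F : ∀ {x m} → ¬ (S x × ¬ x ⁻¹ ≡ x) → ¬ F m x
      outside-F out (x∈S , x≢x⁻¹ , _) = out (x∈S , x≢x⁻¹ ∘ sym)

      outside-I : ∀ {x m} → ¬ (S x × ¬ x ⁻¹ ≡ x) → ¬ I m x
      outside-I out (x∈S , x≢x⁻¹ , _) = out (x∈S , x≢x⁻¹ ∘ sym)

      outside-∑∣μFF : ∀ {x} → ¬ (S x × ¬ x ⁻¹ ≡ x) → ∑∣ r (λ d q → μ q *ℤ 𝟙 (FF? d x)) ≡ + 0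
      outside-∑∣μFF {x} out =
        ∑∣-𝟙-none r μ-of-cofactor (λ d → FF? d x) λ d (x∈S , _ , x⁻¹≢x) → out (x∈S , x⁻¹≢x)

      ∑∣μFF-fixing : ∀ {x} (orb : FixingOrbit x) →
        ∑∣ r (λ d q → μ q *ℤ 𝟙 (FF? d x)) ≡ 𝟙 (FixingOrbit.τ orb ≟ r)
      ∑∣μFF-fixing {x} orb = trans (∑∣-𝟙-⇔ r μ-of-cofactor (λ d → FF? d x) (τ ∣?_) FF⇔)
                                   (∑∣μ-divisible τ r {{ℕ.>-nonZero τ-pos}})
        where open FixingOrbit orb

      ∑∣μFF-inverting : ∀ {x} (orb : InvertingOrbit x) →
        ∑∣ r (λ d q → μ q *ℤ 𝟙 (FF? d x)) ≡ 𝟙 (2 * InvertingOrbit.τ orb ≟ r)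
      ∑∣μFF-inverting {x} orb = trans (∑∣-𝟙-⇔ r μ-of-cofactor (λ d → FF? d x) (2 * τ ∣?_) FF⇔)
                                      (∑∣μ-divisible (2 * τ) r {{ℕP.m*n≢0 2 τ}})
        where
        open InvertingOrbit orb
        instance _ = ℕ.>-nonZero τ-pos

    𝟙F-odd : ¬ 2 ∣ r → ∀ x → 𝟙 (F? r x) ≡ ∑∣ r (λ d q → μ q *ℤ 𝟙 (FF? d x))
    𝟙F-odd r-odd x with shape x
    ... | outside out   = trans (𝟙-no (F? r x) (outside-F out)) (sym (outside-∑∣μFF out))
    ... | fixing orb    = trans (𝟙-⇔ (F⇔ 1≤r) (F? r x) (τ ≟ r)) (sym (∑∣μFF-fixing orb))
      where open FixingOrbit orb
    ... | inverting orb = trans (𝟙-no (F? r x) (¬F 1≤r)) (sym (trans (∑∣μFF-inverting orb)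
        (𝟙-no (2 * τ ≟ r) λ 2τ≡r → r-odd (divides τ (trans (sym 2τ≡r) (ℕP.*-comm 2 τ))))))
      where open InvertingOrbit orb

    𝟙F-even : 2 ∣ r → ∀ x → 𝟙 (F? r x) ≡ ∑∣ r (λ d q → μ q *ℤ 𝟙 (FF? d x)) - 𝟙 (I? (r / 2) x)
    𝟙F-even (divides h r≡h*2) x with shape x
    ... | outside out   = trans (𝟙-no (F? r x) (outside-F out))
      (sym (cong₂ _-_ (outside-∑∣μFF out) (𝟙-no (I? (r / 2) x) (outside-I out))))
    ... | fixing orb    = trans (𝟙-⇔ (F⇔ 1≤r) (F? r x) (τ ≟ r)) (sym (trans
      (cong₂ _-_ (∑∣μFF-fixing orb) (𝟙-no (I? (r / 2) x) (¬I (r / 2)))) (ℤP.+-identityʳ _)))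
      where open FixingOrbit orb
    ... | inverting orb = trans (𝟙-no (F? r x) (¬F 1≤r)) (sym (trans
      (cong₂ _-_ (∑∣μFF-inverting orb) (𝟙-⇔ (I⇔ 1≤r/2) (I? (r / 2) x) (τ ≟ r / 2)))
      (trans (cong (_- 𝟙 (τ ≟ r / 2)) (𝟙-⇔ 2τ≡r⇔τ≡r/2 (2 * τ ≟ r) (τ ≟ r / 2)))
             (ℤP.+-inverseʳ (𝟙 (τ ≟ r / 2))))))
      where
      open InvertingOrbit orb
      r/2≡h : r / 2 ≡ h
      r/2≡h = trans (cong (_/ 2) r≡h*2) (m*n/n≡m h 2)
      1≤r/2 : 1 ≤ r / 2
      1≤r/2 = subst (1 ≤_) (sym r/2≡h) (ℕP.n≢0⇒n>0 λ { refl → ℕP.<⇒≢ 1≤r (sym r≡h*2) })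
      2τ≡r⇔τ≡r/2 : 2 * τ ≡ r ⇔ τ ≡ r / 2
      2τ≡r⇔τ≡r/2 = mk⇔
        (λ 2τ≡r → trans (ℕP.*-cancelʳ-≡ τ h 2 (trans (ℕP.*-comm τ 2) (trans 2τ≡r r≡h*2))) (sym r/2≡h))
        (λ τ≡r/2 → trans (cong (2 *_) (trans τ≡r/2 r/2≡h)) (trans (ℕP.*-comm 2 h) (sym r≡h*2)))

    𝟙Fo : ∀ x → 𝟙 (Fo? r x) ≡ ∑∣ r (λ d q → μ q *ℤ 𝟙 (FFo? d x))
    𝟙Fo x with involution? x
    ... | inj₁ out = trans (𝟙-no (Fo? r x) (λ (x∈S , x⁻¹≡x , x≢e , _) → out (x∈S , x⁻¹≡x , x≢e)))
      (sym (∑∣-𝟙-none r μ-of-cofactor (λ d → FFo? d x) λ d (x∈S , _ , x⁻¹≡x , x≢e) → out (x∈S , x⁻¹≡x , x≢e)))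
    ... | inj₂ orb = trans (𝟙-⇔ (Fo⇔ 1≤r) (Fo? r x) (τ ≟ r)) (sym (trans
      (∑∣-𝟙-⇔ r μ-of-cofactor (λ d → FFo? d x) (τ ∣?_) FFo⇔) (∑∣μ-divisible τ r {{ℕ.>-nonZero τ-pos}})))
      where open InvolutionOrbit orb

    𝟙I : ∀ x → 𝟙 (I? r x) ≡ ∑∣ r (λ d q → 𝟙 (¬? (2 ∣? q)) *ℤ μ q *ℤ 𝟙 (II? d x))
    𝟙I x with shape x
    ... | outside out   = trans (𝟙-no (I? r x) (outside-I out)) (sym
      (∑∣-𝟙-none r odd-μ-of-cofactor (λ d → II? d x) λ d (x∈S , _ , x⁻¹≢x) → out (x∈S , x⁻¹≢x)))
    ... | fixing orb    = trans (𝟙-no (I? r x) (¬I r)) (sym (∑∣-𝟙-none r odd-μ-of-cofactor (λ d → II? d x) ¬II))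
      where open FixingOrbit orb
    ... | inverting orb = trans (𝟙-⇔ (I⇔ 1≤r) (I? r x) (τ ≟ r)) (sym (trans
      (∑∣-𝟙-⇔ r odd-μ-of-cofactor (λ d → II? d x) (λ d → τ ∣? d ×-dec ¬? (2 * τ ∣? d)) II⇔)
      (∑∣μ-odd τ r {{ℕ.>-nonZero τ-pos}})))
      where open InvertingOrbit orb

    F⇒∣o : ∀ x → F r x → r ∣ o
    F⇒∣o x Frx with shape x
    ... | outside out   = ⊥-elim (outside-F out Frx)
    ... | fixing orb    = subst (_∣ o) (Equivalence.to (F⇔ 1≤r) Frx) τ∣o
      where open FixingOrbit orb
    ... | inverting orb = ⊥-elim (InvertingOrbit.¬F orb 1≤r Frx)

    Fo⇒∣o : ∀ x → Fo r x → r ∣ o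
    Fo⇒∣o x Forx@(x∈S , x⁻¹≡x , x≢e , _) with involution? x
    ... | inj₁ out = ⊥-elim (out (x∈S , x⁻¹≡x , x≢e))
    ... | inj₂ orb = subst (_∣ o) (Equivalence.to (Fo⇔ 1≤r) Forx) τ∣o
      where open InvolutionOrbit orb

    I⇒2*∣o : ∀ x → I r x → 2 * r ∣ o
    I⇒2*∣o x Irx with shape x
    ... | outside out   = ⊥-elim (outside-I out Irx)
    ... | fixing orb    = ⊥-elim (FixingOrbit.¬I orb r Irx)
    ... | inverting orb = subst (λ t → 2 * t ∣ o) (Equivalence.to (I⇔ 1≤r) Irx) 2τ∣o
      where open InvertingOrbit orb

lemma3p4 : (A : FiniteGroup) (α : Fin (FiniteGroup.n A) → Fin (FiniteGroup.n A)) →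
    IsAutomorphism A α →
    (o : ℕ) → IsOrderOf α o →
    (r : ℕ) → 1 ≤ r →
    (S : Pred (Fin (FiniteGroup.n A)) 0ℓ) (S? : Decidable S) →
    IsSubgroup A S → IsInvariant α S →
    let open Sets A α S S? in
    ((r ∣ o → ¬ (2 ∣ r) →
        + |F| r ≡ divSum r (λ d q → μ q *ℤ + |FF| d))
    × (r ∣ o → 2 ∣ r →
        + |F| r ≡ divSum r (λ d q → μ q *ℤ + |FF| d) - + |I| (r / 2))
    × (¬ (r ∣ o) → |F| r ≡ 0))
    × ((r ∣ o → + |Fo| r ≡ divSum r (λ d q → μ q *ℤ + |FFo| d))
    × (¬ (r ∣ o) → |Fo| r ≡ 0))
    × ((2 * r ∣ o →
        + |I| r ≡ divSumIf r (λ d q → odd? q) (λ d q → μ q *ℤ + |II| d))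
    × (¬ (2 * r ∣ o) → |I| r ≡ 0))
lemma3p4 A α aut o ord r 1≤r S S? _ _ =
  ( (λ _ r-odd → trans (+count-via-∑∣ r μ-of-cofactor (F? r) FF? (𝟙F-odd r-odd)) (sym (divSum≡∑∣ r μ|FF|)))
  , (λ _ r-even → F-even r-even)
  , (λ r∤o → count-none (F? r) λ x → r∤o ∘ F⇒∣o x) )
  , ( (λ _ → trans (+count-via-∑∣ r μ-of-cofactor (Fo? r) FFo? 𝟙Fo) (sym (divSum≡∑∣ r μ|FFo|)))
    , (λ r∤o → count-none (Fo? r) λ x → r∤o ∘ Fo⇒∣o x) )
  , ( (λ _ → trans (+count-via-∑∣ r odd-μ-of-cofactor (I? r) II? 𝟙I)
             (trans (∑∣-cong r λ d q _ → ℤP.*-assoc (𝟙 (¬? (2 ∣? q))) (μ q) (+ |II| d))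
                    (sym (divSumIf-𝟙 r (λ _ q → ¬? (2 ∣? q)) μ|II|))))
    , (λ 2r∤o → count-none (I? r) λ x → 2r∤o ∘ I⇒2*∣o x) )
  where
  open Sets A α S S?
  open Orbits A α aut ord S S?
  open PointwiseCounts 1≤r
  n = FiniteGroup.n A
  μ|FF| μ|FFo| μ|II| : ℕ → ℕ → ℤ
  μ|FF|  d q = μ q *ℤ + |FF| d
  μ|FFo| d q = μ q *ℤ + |FFo| d
  μ|II|  d q = μ q *ℤ + |II| d
  F-even : 2 ∣ r → + |F| r ≡ divSum r μ|FF| - + |I| (r / 2)
  F-even r-even = begin
    + |F| r                                                     ≡⟨ count≡∑𝟙 (F? r) ⟩
    ∑[ x < n ] 𝟙 (F? r x)                                       ≡⟨ sum-cong-≗ (𝟙F-even r-even) ⟩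
    ∑[ x < n ] (∑∣ r (λ d q → μ q *ℤ 𝟙 (FF? d x)) - 𝟙 (I? (r / 2) x))
      ≡⟨ ∑-distrib-- n (λ x → ∑∣ r (λ d q → μ q *ℤ 𝟙 (FF? d x))) (λ x → 𝟙 (I? (r / 2) x)) ⟩
    ∑[ x < n ] ∑∣ r (λ d q → μ q *ℤ 𝟙 (FF? d x)) - ∑[ x < n ] 𝟙 (I? (r / 2) x)
      ≡⟨ cong₂ _-_ (∑-∑∣-count r μ-of-cofactor FF?) (sym (count≡∑𝟙 (I? (r / 2)))) ⟩
    ∑∣ r μ|FF| - + |I| (r / 2)                                  ≡⟨ cong (_- + |I| (r / 2)) (divSum≡∑∣ r μ|FF|) ⟨
    divSum r μ|FF| - + |I| (r / 2)                              ∎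
    where open ≡-Reasoning
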